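{- Let $n\ge1$, $p$ a prime, $R\subset E_n$ and $S\subset E_n$ with $|S|\ge2$. The following are equivalent: (i) $\mathcal{C}_{R,S}=\mathcal{C}_{\mathsf{pHa},S}$; (ii) $\mathcal{C}_{\mathsf{pHa},S}$ is homogeneous, i.e. there is $T\subset E_n$ with $\mathcal{C}_{\mathsf{pHa},S}=\{x\in\mathbb{Z}^n:F^{(s)}_T(x)\le0\ \forall s\in S\}$; (iii) for every connected component $C$ of the chain diagram $\Gamma_n(R,S)$, the integers $|C\cap R|$ and $|C|$ have different parity.
   Context: $E_n=\{1,\dots,n\}$, indices mod $n$; $e_i$ standard basis of $\mathbb{Z}^n$; $\delta_T^{(m)}=-1$ if $m\in T$, $1$ otherwise; $F^{(d)}_T(x)=\sum_{j=0}^{n-1}p^j\delta_T^{(d+j)}x_{d+j}$. The chain diagram $\Gamma_n(R,S)$ is the graph with vertex set $E_n$ and an edge between $i$ and $i+1$ exactly when $i+1\notin S$. Let $\Phi_R(S)$ be the unique $T\subset E_n$ such that $s-1\in T\iff s-1\in R$ for all $s\in S$ and, for every $i$ with $i+1\notin S$, exactly one of $i,i+1$ is in $T$ if $i\notin R$, and both or neither if $i\in R$; set $\mathcal{C}_{R,S}=\{x:F^{(s)}_{\Phi_R(S)}(x)\le0\ \forall s\in S\}$. Put $\mathsf{ha}^{(i)}_{R,S}=-\delta_S^{(i)}e_i-p\delta_R^{(i-1)}e_{i-1}$ and let $\mathcal{C}_{\mathsf{pHa},S}=\{x\in\mathbb{Z}^n: mx\in\sum_{i\in S}\mathbb{N}\,\mathsf{ha}^{(i)}_{R,S}+\sum_{i\notin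 S}\mathbb{Z}\,\mathsf{ha}^{(i)}_{R,S}\text{ for some } m\ge1\}$. -}

module Defs where

open import Data.Nat as ℕ using (ℕ; zero; suc; NonZero; _∸_)
open import Data.Nat.DivMod using (_mod_)
open import Data.Integer as ℤ using (ℤ; +_; -_; _+_; _*_; _≤_; 0ℤ; 1ℤ)
open import Data.Fin as Fin using (Fin; toℕ)
open import Data.Fin.Subset using (Subset; _∈_; _∉_; _∩_; ∣_∣; Nonempty)
open import Data.Fin.Subset.Properties using (_∈?_)
open import Data.Bool using (if_then_else_)
open import Relation.Nullary using (does; ¬_)
open import Relation.Binary.PropositionalEquality using (_≡_)
open import Relation.Binary.Construct.Closure.ReflexiveTransitive using (Star)
open import Data.Product using (Σ; _×_; ∃; ∃-syntax)
open import Data.Sum using (_⊎_)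
open import Function.Bundles using (_⇔_)

sumℕ< : ℕ → (ℕ → ℤ) → ℤ
sumℕ< zero    f = 0ℤ
sumℕ< (suc k) f = sumℕ< k f + f k

sumFin : ∀ {n} → (Fin n → ℤ) → ℤ
sumFin {zero}  f = 0ℤ
sumFin {suc n} f = f Fin.zero + sumFin (λ i → f (Fin.suc i))

-- E_n is modelled as Fin n = {0,…,n-1} (0-based relabelling of {1,…,n});
-- indices are taken mod n.  Points of ℤ^n are functions Fin n → ℤ.

module _ {n : ℕ} .{{_ : NonZero n}} where

  _⊕_ : Fin n → ℕ → Fin n
  d ⊕ j = (toℕ d ℕ.+ j) mod n

  next : Fin n → Fin n
  next i = i ⊕ 1

  prev : Fin n → Fin n
  prev i = i ⊕ (n ∸ 1)

  δ : Subset n → Fin n → ℤ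
  δ T m = if does (m ∈? T) then - 1ℤ else 1ℤ

  F : ℕ → Subset n → Fin n → (Fin n → ℤ) → ℤ
  F p T d x = sumℕ< n (λ j → (+ (p ℕ.^ j)) * (δ T (d ⊕ j) * x (d ⊕ j)))

  e : Fin n → Fin n → ℤ
  e i j = if does (i Fin.≟ j) then 1ℤ else 0ℤ

  ha : ℕ → Subset n → Subset n → Fin n → Fin n → ℤ
  ha p R S i j = (- (δ S i * e i j)) + (- ((+ p) * (δ R (prev i) * e (prev i) j)))

  IsΦ : Subset n → Subset n → Subset n → Set
  IsΦ R S T =
    (∀ s → s ∈ S → (prev s ∈ T ⇔ prev s ∈ R)) ×
    (∀ i → next i ∉ S →
       (i ∉ R → (i ∈ T × next i ∉ T) ⊎ (i ∉ T × next i ∈ T)) ×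
       (i ∈ R → (i ∈ T × next i ∈ T) ⊎ (i ∉ T × next i ∉ T)))

  HomCone : ℕ → Subset n → Subset n → (Fin n → ℤ) → Set
  HomCone p T S x = ∀ s → s ∈ S → F p T s x ≤ 0ℤ

  -- 𝒞_{R,S} = HomCone for T = Φ_R(S)  (Φ_R(S) is unique by the paper)
  C-RS : ℕ → Subset n → Subset n → (Fin n → ℤ) → Set
  C-RS p R S x = Σ (Subset n) λ T → (IsΦ R S T × HomCone p T S x)

  C-pHa : ℕ → Subset n → Subset n → (Fin n → ℤ) → Set
  C-pHa p R S x =
    Σ ℕ λ m → (1 ℕ.≤ m ×
      Σ (Fin n → ℤ) λ c → ((∀ i → i ∈ S → 0ℤ ≤ c i) ×
              (∀ j → (+ m) * x j ≡ sumFin (λ i → c i * ha p R S i j))))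

  -- chain diagram Γ_n(R,S): edge {i, i+1} exactly when i+1 ∉ S
  -- (it does not depend on R)
  Edge : Subset n → Fin n → Fin n → Set
  Edge S i j = (j ≡ next i × next i ∉ S) ⊎ (i ≡ next j × next j ∉ S)

  Connected : Subset n → Fin n → Fin n → Set
  Connected S = Star (Edge S)

  IsComponent : Subset n → Subset n → Set
  IsComponent S C =
    Nonempty C ×
    (∀ i j → i ∈ C → Edge S i j → j ∈ C) ×
    (∀ i j → i ∈ C → j ∈ C → Connected S i j)

{-# OPTIONS --safe #-}
module Submission where

-- Put β_T(j) = δ_R(j)δ_T(j) + δ_S(j+1)δ_T(j+1).  For y = Σ_i c_i ha^{(i)} the sum F^{(d)}_T(y)
-- telescopes to (p^n − 1)δ_S(d)δ_T(d)c_d − Σ_k p^{k+1} β_T(d+k) c_{d+k+1}.  So if β_T ≡ 0 and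
-- T ∩ S = ∅ ("T is adapted"), 𝒞_pHa is the cone of T: the coefficients of a point x of that cone
-- are read back as c_i = δ_S(i)δ_T(i)F^{(i)}_T(x).  Conversely, if 𝒞_pHa is the cone of some T,
-- testing with the points ±e_k and applying F^{(s)} for the signs propagated from s ∈ S shows that
-- β_T vanishes off s − 1, hence everywhere since |S| ≥ 2, and testing with ha^{(s)} gives T ∩ S = ∅.
-- Finally, β_T ≡ 0 is the recursion defining Φ_R(S) along the arcs of Γ_n(R,S), and summing it
-- mod 2 over a component C shows that the value of T at the start of C is 0 exactly when
-- |C ∩ R| + |C| is odd.  Hence (ii) ⇒ T adapted ⇒ (iii) ⇒ Φ_R(S) adapted ⇒ (i) ⇒ (ii).

open import Defs
open import Algebra.Bundles using (CommutativeRing)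
open import Data.Bool using (Bool; true; false; not; _xor_; _∧_; if_then_else_)
import Data.Bool.Properties as Boolₚ
open import Algebra.Properties.CommutativeMonoid.Sum (CommutativeRing.+-commutativeMonoid Boolₚ.xor-∧-commutativeRing)
  using () renaming (sum to xorSum; sum-cong-≗ to xorSum-cong; ∑-distrib-+ to xorSum-distrib-xor;
                     sum-permute to xorSum-permute; sum-replicate-zero to xorSum-false)
open import Data.Empty using (⊥; ⊥-elim)
open import Data.Fin as Fin using (Fin; toℕ)
import Data.Fin.Properties as Finₚ
import Data.Fin.Permutation as Perm
open import Data.Fin.Subset using (Subset; _∈_; _∉_; _∩_; ∣_∣)
open import Data.Fin.Subset.Properties using (_∈?_)
open import Data.Integer as ℤ using (ℤ; +_; -_; _+_; _*_; _-_; 0ℤ; 1ℤ)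
import Data.Integer.Properties as ℤₚ
open import Algebra.Properties.AbelianGroup ℤₚ.+-0-abelianGroup using () renaming (inverseʳ-unique to +-inverseʳ-unique)
open import Data.Integer.Tactic.RingSolver using (solve-∀)
open import Data.Nat as ℕ using (ℕ; zero; suc; NonZero; _≤_; _<_; _∸_; _^_; _%_; z≤n; s≤s)
open import Data.Nat.DivMod using (_mod_; m%n<n; %-distribˡ-+; m%n%n≡m%n; [m+n]%n≡m%n; m<n⇒m%n≡m)
import Data.Nat.Properties as ℕₚ
open import Algebra.Properties.CommutativeSemigroup ℕₚ.+-commutativeSemigroup using () renaming (x∙yz≈y∙xz to x+[y+z]≡y+[x+z])
open import Data.Nat.Primality using (Prime; prime⇒nonTrivial)
open import Data.Product using (Σ; _×_; _,_; proj₁; proj₂; ∃-syntax)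
open import Data.Sum using (_⊎_; inj₁; inj₂)
open import Data.Vec using (lookup; tabulate; _∷_; [])
open import Data.Vec.Properties using ([]=⇒lookup; lookup⇒[]=; lookup∘tabulate; lookup-zipWith)
open import Function using (_∘_)
open import Function.Bundles using (_⇔_; mk⇔; Equivalence)
import Function.Properties.Equivalence as ⇔
open import Relation.Binary.Construct.Closure.ReflexiveTransitive using (ε; _◅_; _◅◅_; reverse)
open import Relation.Binary.PropositionalEquality
open import Relation.Nullary using (does; Dec; yes; no)

open ≡-Reasoning

sign : Bool → ℤ
sign b = if b then - 1ℤ else 1ℤ

sign-square : ∀ b → sign b * sign b ≡ 1ℤ
sign-square true  = refl
sign-square false = refl

sign-xor : ∀ a b → sign a * sign b ≡ sign (a xor b)
sign-xor true  true  = refl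
sign-xor true  false = refl
sign-xor false true  = refl
sign-xor false false = refl

sign+sign≡0⇔ : ∀ x y → sign x + sign y ≡ 0ℤ ⇔ y ≡ not x
sign+sign≡0⇔ x y = mk⇔ (to x y) (from x y)
  where
  to : ∀ x y → sign x + sign y ≡ 0ℤ → y ≡ not x
  to true  false _ = refl
  to false true  _ = refl
  from : ∀ x y → y ≡ not x → sign x + sign y ≡ 0ℤ
  from true  .false refl = refl
  from false .true  refl = refl

sign-xor-not : ∀ b v → sign b * (sign v * - sign (not (b xor v))) ≡ 1ℤ
sign-xor-not true  true  = refl
sign-xor-not true  false = refl
sign-xor-not false true  = refl
sign-xor-not false false = refl

xor-cancelˡ : ∀ a b → a xor (a xor b) ≡ b
xor-cancelˡ true  b = Boolₚ.not-involutive b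
xor-cancelˡ false b = refl

-- Unprimed values are taken at a vertex k and primed ones at k + 1, c is the indicator of a
-- component, and the hypotheses are its closure and the edge rule along an edge {k, k + 1}.
-- Summed over k, the right-hand side telescopes.
arc-step : ∀ c c′ r s s′ t t′ → (s′ ≡ false → c′ ≡ c) → (s′ ≡ false → t′ ≡ not (r xor t)) →
  ((c ∧ r) xor c) xor (((c ∧ s) ∧ t) xor ((c ∧ s′) ∧ not (t xor r))) ≡ (c ∧ not s ∧ t) xor (c′ ∧ not s′ ∧ t′)
arc-step c c′ r s true  t t′ _ _ rewrite Boolₚ.∧-zeroʳ c′ = at-end c r s t
  where
  at-end : ∀ c r s t → ((c ∧ r) xor c) xor (((c ∧ s) ∧ t) xor ((c ∧ true) ∧ not (t xor r))) ≡ (c ∧ not s ∧ t) xor false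
  at-end false r     s     t     = refl
  at-end true  true  true  true  = refl
  at-end true  true  true  false = refl
  at-end true  true  false true  = refl
  at-end true  true  false false = refl
  at-end true  false true  true  = refl
  at-end true  false true  false = refl
  at-end true  false false true  = refl
  at-end true  false false false = refl
arc-step c c′ r s false t t′ c′≡c t′≡ rewrite c′≡c refl | t′≡ refl = along c r s t
  where
  along : ∀ c r s t → ((c ∧ r) xor c) xor (((c ∧ s) ∧ t) xor ((c ∧ false) ∧ not (t xor r))) ≡ (c ∧ not s ∧ t) xor (c ∧ true ∧ not (r xor t))
  along false r     s     t     = refl
  along true  true  true  true  = refl
  along true  true  true  false = refl
  along true  true  false true  = refl
  along true  true  false false = refl
  along true  false true  true  = refl
  along true  false true  false = refl
  along true  false false true  = refl
  along true  false false false = refl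

xor≡false⇒≡ : ∀ {a b} → a xor b ≡ false → a ≡ b
xor≡false⇒≡ {true}  {true}  _ = refl
xor≡false⇒≡ {false} {false} _ = refl

≡not-xor-swap : ∀ r t t′ → t ≡ not (r xor t′) → t′ ≡ not (r xor t)
≡not-xor-swap true  true  true  refl = refl
≡not-xor-swap true  false false refl = refl
≡not-xor-swap false true  false refl = refl
≡not-xor-swap false false true  refl = refl

module _ {n : ℕ} {k : Fin n} {X : Subset n} where

  ∈⇒lookup : k ∈ X → lookup X k ≡ true
  ∈⇒lookup = []=⇒lookup

  lookup⇒∈ : lookup X k ≡ true → k ∈ X
  lookup⇒∈ = lookup⇒[]= k X

  ∉⇒lookup : k ∉ X → lookup X k ≡ false
  ∉⇒lookup k∉X with lookup X k in eq
  ... | true  = ⊥-elim (k∉X (lookup⇒∈ eq))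
  ... | false = refl

  lookup⇒∉ : lookup X k ≡ false → k ∉ X
  lookup⇒∉ eq k∈X with trans (sym (∈⇒lookup k∈X)) eq
  ... | ()

does-∈? : ∀ {n} (k : Fin n) (X : Subset n) → does (k ∈? X) ≡ lookup X k
does-∈? Fin.zero    (true  ∷ X) = refl
does-∈? Fin.zero    (false ∷ X) = refl
does-∈? (Fin.suc k) (b ∷ X)     = does-∈? k X

δ-sign : ∀ {n} .{{_ : NonZero n}} (X : Subset n) k → δ X k ≡ sign (lookup X k)
δ-sign X k = cong sign (does-∈? k X)

parity : ℕ → Bool
parity zero    = false
parity (suc m) = not (parity m)

private
  bit : Bool → ℕ
  bit b = if b then 1 else 0

  bit-injective : ∀ {a b} → bit a ≡ bit b → a ≡ b
  bit-injective {true}  {true}  _ = refl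
  bit-injective {false} {false} _ = refl

%2≡bit-parity : ∀ m → m % 2 ≡ bit (parity m)
%2≡bit-parity zero          = refl
%2≡bit-parity (suc zero)    = refl
%2≡bit-parity (suc (suc m)) = begin
  (2 ℕ.+ m) % 2     ≡⟨ cong (_% 2) (ℕₚ.+-comm 2 m) ⟩
  (m ℕ.+ 2) % 2     ≡⟨ [m+n]%n≡m%n m 2 ⟩
  m % 2             ≡⟨ %2≡bit-parity m ⟩
  bit (parity m)    ≡⟨ cong bit (Boolₚ.not-involutive (parity m)) ⟨
  bit (parity (suc (suc m))) ∎

xor≡true⇔≢ : ∀ {a b} → a xor b ≡ true ⇔ a ≢ b
xor≡true⇔≢ = mk⇔ to from
  where
  to : ∀ {a b} → a xor b ≡ true → a ≢ b
  to {true}  {true}  () refl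
  to {false} {false} () refl
  from : ∀ {a b} → a ≢ b → a xor b ≡ true
  from {true}  {true}  ne = ⊥-elim (ne refl)
  from {true}  {false} _  = refl
  from {false} {true}  _  = refl
  from {false} {false} ne = ⊥-elim (ne refl)

%2≢⇔parity-xor : ∀ m k → (m % 2 ≢ k % 2) ⇔ (parity m xor parity k ≡ true)
%2≢⇔parity-xor m k = mk⇔
  (λ ne → Equivalence.from xor≡true⇔≢ (λ eq → ne (trans (%2≡bit-parity m) (trans (cong bit eq) (sym (%2≡bit-parity k))))))
  (λ x eq → Equivalence.to xor≡true⇔≢ x (bit-injective (trans (sym (%2≡bit-parity m)) (trans eq (%2≡bit-parity k)))))

parity-∣∣ : ∀ {m} (X : Subset m) → parity ∣ X ∣ ≡ xorSum (lookup X)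
parity-∣∣ []          = refl
parity-∣∣ (true ∷ X)  = cong not (parity-∣∣ X)
parity-∣∣ (false ∷ X) = parity-∣∣ X

xorSum-single : ∀ {m} (f : Fin m → Bool) (k₀ : Fin m) → (∀ k → k ≢ k₀ → f k ≡ false) → xorSum f ≡ f k₀
xorSum-single {suc m} f Fin.zero vanish = begin
  f Fin.zero xor xorSum (λ i → f (Fin.suc i)) ≡⟨ cong (f Fin.zero xor_) (xorSum-cong (λ i → vanish (Fin.suc i) λ ())) ⟩
  f Fin.zero xor xorSum {m} (λ _ → false)     ≡⟨ cong (f Fin.zero xor_) (xorSum-false m) ⟩
  f Fin.zero xor false                        ≡⟨ Boolₚ.xor-identityʳ (f Fin.zero) ⟩
  f Fin.zero ∎
xorSum-single {suc m} f (Fin.suc k₀) vanish = begin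
  f Fin.zero xor xorSum (λ i → f (Fin.suc i)) ≡⟨ cong (_xor xorSum (λ i → f (Fin.suc i))) (vanish Fin.zero λ ()) ⟩
  xorSum (λ i → f (Fin.suc i))                ≡⟨ xorSum-single (λ i → f (Fin.suc i)) k₀ (λ k ne → vanish (Fin.suc k) (ne ∘ Finₚ.suc-injective)) ⟩
  f (Fin.suc k₀) ∎

∧≡true⇒ : ∀ {x y} → x ∧ y ≡ true → x ≡ true × y ≡ true
∧≡true⇒ {true} {true} _ = refl , refl

xorSum-∧-unique : ∀ {m} (u f : Fin m → Bool) a → u a ≡ true → (∀ k → u k ≡ true → k ≡ a) → xorSum (λ k → u k ∧ f k) ≡ f a
xorSum-∧-unique u f a ua unique = trans (xorSum-single (λ k → u k ∧ f k) a vanish) (cong (_∧ f a) ua)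
  where
  vanish : ∀ k → k ≢ a → u k ∧ f k ≡ false
  vanish k k≢a with u k in uk
  ... | true  = ⊥-elim (k≢a (unique k uk))
  ... | false = refl


sumℕ<-cong : ∀ m {f g : ℕ → ℤ} → (∀ k → k < m → f k ≡ g k) → sumℕ< m f ≡ sumℕ< m g
sumℕ<-cong zero    eq = refl
sumℕ<-cong (suc m) eq = cong₂ _+_ (sumℕ<-cong m (λ k k<m → eq k (ℕₚ.m<n⇒m<1+n k<m))) (eq m ℕₚ.≤-refl)

sumℕ<-distrib-+ : ∀ m (f g : ℕ → ℤ) → sumℕ< m (λ k → f k + g k) ≡ sumℕ< m f + sumℕ< m g
sumℕ<-distrib-+ zero    f g = refl
sumℕ<-distrib-+ (suc m) f g = trans (cong (_+ (f m + g m)) (sumℕ<-distrib-+ m f g)) (interchange (sumℕ< m f) (sumℕ< m g) (f m) (g m))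
  where
  interchange : ∀ (a b c d : ℤ) → (a + b) + (c + d) ≡ (a + c) + (b + d)
  interchange = solve-∀

sumℕ<-*ˡ : ∀ m (a : ℤ) (f : ℕ → ℤ) → sumℕ< m (λ k → a * f k) ≡ a * sumℕ< m f
sumℕ<-*ˡ zero    a f = sym (ℤₚ.*-zeroʳ a)
sumℕ<-*ˡ (suc m) a f = trans (cong (_+ a * f m) (sumℕ<-*ˡ m a f)) (sym (ℤₚ.*-distribˡ-+ a (sumℕ< m f) (f m)))

sumℕ<-neg : ∀ m (f : ℕ → ℤ) → sumℕ< m (λ k → - f k) ≡ - sumℕ< m f
sumℕ<-neg zero    f = refl
sumℕ<-neg (suc m) f = trans (cong (_+ - f m) (sumℕ<-neg m f)) (sym (ℤₚ.neg-distrib-+ (sumℕ< m f) (f m)))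

sumℕ<-zero : ∀ m → sumℕ< m (λ _ → 0ℤ) ≡ 0ℤ
sumℕ<-zero zero    = refl
sumℕ<-zero (suc m) = cong (_+ 0ℤ) (sumℕ<-zero m)

sumℕ<-single : ∀ m (f : ℕ → ℤ) j₀ → j₀ < m → (∀ k → k < m → k ≢ j₀ → f k ≡ 0ℤ) → sumℕ< m f ≡ f j₀
sumℕ<-single (suc m) f j₀ j₀<1+m vanish with j₀ ℕ.≟ m
... | yes refl = begin
  sumℕ< m f + f m       ≡⟨ cong (_+ f m) (trans (sumℕ<-cong m (λ k k<m → vanish k (ℕₚ.m<n⇒m<1+n k<m) (ℕₚ.<⇒≢ k<m))) (sumℕ<-zero m)) ⟩
  0ℤ + f m              ≡⟨ ℤₚ.+-identityˡ (f m) ⟩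
  f m ∎
... | no j₀≢m = begin
  sumℕ< m f + f m       ≡⟨ cong₂ _+_ (sumℕ<-single m f j₀ (ℕₚ.≤∧≢⇒< (ℕₚ.≤-pred j₀<1+m) j₀≢m) (λ k k<m → vanish k (ℕₚ.m<n⇒m<1+n k<m)))
                                     (vanish m ℕₚ.≤-refl (j₀≢m ∘ sym)) ⟩
  f j₀ + 0ℤ             ≡⟨ ℤₚ.+-identityʳ (f j₀) ⟩
  f j₀ ∎

sumℕ<-last : ∀ m .{{_ : NonZero m}} (f : ℕ → ℤ) → (∀ k → suc k < m → f k ≡ 0ℤ) → sumℕ< m f ≡ f (m ∸ 1)
sumℕ<-last (suc m) f vanish = sumℕ<-single (suc m) f m ℕₚ.≤-refl (λ k k<1+m k≢m → vanish k (s≤s (ℕₚ.≤∧≢⇒< (ℕₚ.≤-pred k<1+m) k≢m)))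

sumℕ<-powers-shift : ∀ p m (h : ℕ → ℤ) →
  + p * sumℕ< m (λ k → + (p ^ k) * h (suc k)) ≡ sumℕ< m (λ k → + (p ^ k) * h k) - h 0 + + (p ^ m) * h m
sumℕ<-powers-shift p zero    h = base (+ p) (h 0)
  where
  base : ∀ (q h₀ : ℤ) → q * 0ℤ ≡ 0ℤ - h₀ + 1ℤ * h₀
  base = solve-∀
sumℕ<-powers-shift p (suc m) h = begin
  + p * (Σ₁ + + (p ^ m) * h (suc m))         ≡⟨ ℤₚ.*-distribˡ-+ (+ p) Σ₁ _ ⟩
  + p * Σ₁ + + p * (+ (p ^ m) * h (suc m))    ≡⟨ cong₂ _+_ (sumℕ<-powers-shift p m h) (sym (ℤₚ.*-assoc (+ p) _ _)) ⟩
  Σ₀ - h 0 + + (p ^ m) * h m + + p * + (p ^ m) * h (suc m)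
                                              ≡⟨ cong (λ q → Σ₀ - h 0 + + (p ^ m) * h m + q * h (suc m)) (ℤₚ.pos-* p (p ^ m)) ⟨
  Σ₀ - h 0 + + (p ^ m) * h m + + (p ^ suc m) * h (suc m)
                                              ≡⟨ regroup Σ₀ (h 0) (+ (p ^ m) * h m) (+ (p ^ suc m) * h (suc m)) ⟩
  Σ₀ + + (p ^ m) * h m - h 0 + + (p ^ suc m) * h (suc m) ∎
  where
  Σ₀ = sumℕ< m (λ k → + (p ^ k) * h k)
  Σ₁ = sumℕ< m (λ k → + (p ^ k) * h (suc k))
  regroup : ∀ (a b c d : ℤ) → a - b + c + d ≡ a + c - b + d
  regroup = solve-∀

sumℕ<-powers-telescope : ∀ p m (w : ℕ → ℤ) →
  sumℕ< m (λ k → + (p ^ k) * (- w k + + p * w (suc k))) ≡ + (p ^ m) * w m - w 0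
sumℕ<-powers-telescope p m w = begin
  sumℕ< m (λ k → + (p ^ k) * (- w k + + p * w (suc k)))
    ≡⟨ sumℕ<-cong m (λ k _ → expand (+ (p ^ k)) (+ p) (w k) (w (suc k))) ⟩
  sumℕ< m (λ k → - (+ (p ^ k) * w k) + + p * (+ (p ^ k) * w (suc k)))
    ≡⟨ sumℕ<-distrib-+ m _ _ ⟩
  sumℕ< m (λ k → - (+ (p ^ k) * w k)) + sumℕ< m (λ k → + p * (+ (p ^ k) * w (suc k)))
    ≡⟨ cong₂ _+_ (sumℕ<-neg m _) (sumℕ<-*ˡ m (+ p) _) ⟩
  - Σ₀ + + p * sumℕ< m (λ k → + (p ^ k) * w (suc k))
    ≡⟨ cong (λ s → - Σ₀ + s) (sumℕ<-powers-shift p m w) ⟩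
  - Σ₀ + (Σ₀ - w 0 + + (p ^ m) * w m)
    ≡⟨ cancel Σ₀ (w 0) (+ (p ^ m) * w m) ⟩
  + (p ^ m) * w m - w 0 ∎
  where
  Σ₀ = sumℕ< m (λ k → + (p ^ k) * w k)
  expand : ∀ (q p w₀ w₁ : ℤ) → q * (- w₀ + p * w₁) ≡ - (q * w₀) + p * (q * w₁)
  expand = solve-∀
  cancel : ∀ (s w₀ t : ℤ) → - s + (s - w₀ + t) ≡ t - w₀
  cancel = solve-∀

-- multiplying by sign b makes the left side positive and the right side c (sign b − P) ≤ 0
sign-mismatch : ∀ b (m P : ℕ) (f c : ℤ) → 1 ≤ m → 2 ≤ P → 0ℤ ℤ.≤ c → 0ℤ ℤ.< sign b * f →
  + m * f ≢ c * (1ℤ - + P * sign b)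
sign-mismatch b m@(suc _) P f c _ 2≤P 0≤c 0<σf eq =
  ℤₚ.<-irrefl refl (ℤₚ.<-≤-trans 0<σ[mf] (ℤₚ.≤-trans (ℤₚ.≤-reflexive (cong (sign b *_) eq)) σ[rhs]≤0))
  where
  0<σ[mf] : 0ℤ ℤ.< sign b * (+ m * f)
  0<σ[mf] = subst₂ ℤ._<_ (ℤₚ.*-zeroʳ (+ m)) (swap (+ m) (sign b) f) (ℤₚ.*-monoˡ-<-pos (+ m) 0<σf)
    where
    swap : ∀ (m s f : ℤ) → m * (s * f) ≡ s * (m * f)
    swap = solve-∀
  σ-P≤0 : sign b - + P ℤ.≤ 0ℤ
  σ-P≤0 = ℤₚ.i≤j⇒i-j≤0 (ℤₚ.≤-trans (σ≤1 b) (ℤ.+≤+ (ℕₚ.≤-trans (s≤s z≤n) 2≤P)))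
    where
    σ≤1 : ∀ b → sign b ℤ.≤ 1ℤ
    σ≤1 true  = ℤ.-≤+
    σ≤1 false = ℤₚ.≤-refl
  σ[rhs]≤0 : sign b * (c * (1ℤ - + P * sign b)) ℤ.≤ 0ℤ
  σ[rhs]≤0 = subst₂ ℤ._≤_ (sym σ[rhs]) (ℤₚ.*-zeroʳ c) (ℤₚ.*-monoˡ-≤-nonNeg c {{ℤ.nonNegative 0≤c}} σ-P≤0)
    where
    expand : ∀ (s c q t : ℤ) → s * (c * (1ℤ - q * s)) ≡ c * (s - q * t) + c * q * (t - s * s)
    expand = solve-∀
    σ[rhs] : sign b * (c * (1ℤ - + P * sign b)) ≡ c * (sign b - + P)
    σ[rhs] = begin
      sign b * (c * (1ℤ - + P * sign b))                          ≡⟨ expand (sign b) c (+ P) 1ℤ ⟩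
      c * (sign b - + P * 1ℤ) + c * + P * (1ℤ - sign b * sign b)  ≡⟨ cong₂ (λ u v → c * (sign b - u) + c * + P * (1ℤ - v))
                                                                           (ℤₚ.*-identityʳ (+ P)) (sign-square b) ⟩
      c * (sign b - + P) + c * + P * (1ℤ - 1ℤ)                    ≡⟨ cong (λ u → c * (sign b - + P) + u) (ℤₚ.*-zeroʳ (c * + P)) ⟩
      c * (sign b - + P) + 0ℤ                                      ≡⟨ ℤₚ.+-identityʳ _ ⟩
      c * (sign b - + P) ∎

+[m∸1]≡+m-1 : ∀ {m} → 1 ≤ m → + (m ∸ 1) ≡ + m - 1ℤ
+[m∸1]≡+m-1 {suc _} _ = refl

2≤p^n : ∀ p n .{{_ : NonZero n}} → 2 ≤ p → 2 ≤ p ^ n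
2≤p^n p@(suc _) n 2≤p = ℕₚ.≤-trans 2≤p (subst (_≤ p ^ n) (ℕₚ.*-identityʳ p) (ℕₚ.^-monoʳ-≤ p (ℕ.>-nonZero⁻¹ n)))


sumFin-cong : ∀ {m} {f g : Fin m → ℤ} → (∀ i → f i ≡ g i) → sumFin f ≡ sumFin g
sumFin-cong {zero}  eq = refl
sumFin-cong {suc m} eq = cong₂ _+_ (eq Fin.zero) (sumFin-cong (λ i → eq (Fin.suc i)))

sumFin-distrib-+ : ∀ {m} (f g : Fin m → ℤ) → sumFin (λ i → f i + g i) ≡ sumFin f + sumFin g
sumFin-distrib-+ {zero}  f g = refl
sumFin-distrib-+ {suc m} f g = begin
  (f₀ + g₀) + sumFin (λ i → f (Fin.suc i) + g (Fin.suc i))  ≡⟨ cong (λ s → (f₀ + g₀) + s) (sumFin-distrib-+ (f ∘ Fin.suc) (g ∘ Fin.suc)) ⟩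
  (f₀ + g₀) + (sumFin (f ∘ Fin.suc) + sumFin (g ∘ Fin.suc)) ≡⟨ interchange f₀ g₀ _ _ ⟩
  sumFin f + sumFin g ∎
  where
  f₀ = f Fin.zero
  g₀ = g Fin.zero
  interchange : ∀ (a b c d : ℤ) → (a + b) + (c + d) ≡ (a + c) + (b + d)
  interchange = solve-∀

sumFin-zero : ∀ m → sumFin {m} (λ _ → 0ℤ) ≡ 0ℤ
sumFin-zero zero    = refl
sumFin-zero (suc m) = trans (ℤₚ.+-identityˡ _) (sumFin-zero m)

-- e without its NonZero instance, so that the induction can pass through Fin 0
private
  indicator : ∀ {m} → Fin m → Fin m → ℤ
  indicator i j = if does (i Fin.≟ j) then 1ℤ else 0ℤ

  sumFin-*indicator : ∀ {m} (f : Fin m → ℤ) (j : Fin m) → sumFin (λ i → f i * indicator i j) ≡ f j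
  sumFin-*indicator {suc m} f Fin.zero = begin
    f Fin.zero * 1ℤ + sumFin (λ i → f (Fin.suc i) * 0ℤ) ≡⟨ cong₂ _+_ (ℤₚ.*-identityʳ (f Fin.zero)) (sumFin-cong (λ i → ℤₚ.*-zeroʳ (f (Fin.suc i)))) ⟩
    f Fin.zero + sumFin {m} (λ _ → 0ℤ)                 ≡⟨ cong (λ s → f Fin.zero + s) (sumFin-zero m) ⟩
    f Fin.zero + 0ℤ                                    ≡⟨ ℤₚ.+-identityʳ _ ⟩
    f Fin.zero ∎
  sumFin-*indicator f (Fin.suc j) =
    trans (cong₂ _+_ (ℤₚ.*-zeroʳ (f Fin.zero)) (sumFin-*indicator (f ∘ Fin.suc) j)) (ℤₚ.+-identityˡ _)

module _ {m} .{{_ : NonZero m}} where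

  e-comm : (i j : Fin m) → e i j ≡ e j i
  e-comm i j with i Fin.≟ j | j Fin.≟ i
  ... | yes _   | yes _   = refl
  ... | no  _   | no  _   = refl
  ... | yes i≡j | no  j≢i = ⊥-elim (j≢i (sym i≡j))
  ... | no  i≢j | yes j≡i = ⊥-elim (i≢j (sym j≡i))

  sumFin-*e : (f : Fin m → ℤ) (j : Fin m) → sumFin (λ i → f i * e i j) ≡ f j
  sumFin-*e = sumFin-*indicator

  sumFin-e* : (f : Fin m → ℤ) (j : Fin m) → sumFin (λ i → e j i * f i) ≡ f j
  sumFin-e* f j = trans (sumFin-cong (λ i → trans (ℤₚ.*-comm (e j i) (f i)) (cong (f i *_) (e-comm j i)))) (sumFin-*e f j)

-- Arithmetic on the cycle E_n = ℤ/n

module _ {n : ℕ} .{{_ : NonZero n}} where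

  private
    toℕ-mod : ∀ m → toℕ (m mod n) ≡ m % n
    toℕ-mod m = Finₚ.toℕ-fromℕ< (m%n<n m n)

    toℕ%n : (d : Fin n) → toℕ d % n ≡ toℕ d
    toℕ%n d = m<n⇒m%n≡m (Finₚ.toℕ<n d)

    %n-+ˡ : ∀ a b → (a % n ℕ.+ b) % n ≡ (a ℕ.+ b) % n
    %n-+ˡ a b = begin
      (a % n ℕ.+ b) % n          ≡⟨ %-distribˡ-+ (a % n) b n ⟩
      (a % n % n ℕ.+ b % n) % n  ≡⟨ cong (λ r → (r ℕ.+ b % n) % n) (m%n%n≡m%n a n) ⟩
      (a % n ℕ.+ b % n) % n      ≡⟨ %-distribˡ-+ a b n ⟨
      (a ℕ.+ b) % n ∎

    %n-+ʳ : ∀ a b → (a ℕ.+ b % n) % n ≡ (a ℕ.+ b) % n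
    %n-+ʳ a b = begin
      (a ℕ.+ b % n) % n  ≡⟨ cong (_% n) (ℕₚ.+-comm a (b % n)) ⟩
      (b % n ℕ.+ a) % n  ≡⟨ %n-+ˡ b a ⟩
      (b ℕ.+ a) % n      ≡⟨ cong (_% n) (ℕₚ.+-comm b a) ⟩
      (a ℕ.+ b) % n ∎

  toℕ-⊕ : ∀ (d : Fin n) j → toℕ (d ⊕ j) ≡ (toℕ d ℕ.+ j) % n
  toℕ-⊕ d j = toℕ-mod (toℕ d ℕ.+ j)

  ⊕-⊕ : ∀ (d : Fin n) i j → (d ⊕ i) ⊕ j ≡ d ⊕ (i ℕ.+ j)
  ⊕-⊕ d i j = Finₚ.toℕ-injective (begin
    toℕ ((d ⊕ i) ⊕ j)               ≡⟨ toℕ-⊕ (d ⊕ i) j ⟩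
    (toℕ (d ⊕ i) ℕ.+ j) % n         ≡⟨ cong (λ r → (r ℕ.+ j) % n) (toℕ-⊕ d i) ⟩
    ((toℕ d ℕ.+ i) % n ℕ.+ j) % n   ≡⟨ %n-+ˡ (toℕ d ℕ.+ i) j ⟩
    (toℕ d ℕ.+ i ℕ.+ j) % n         ≡⟨ cong (_% n) (ℕₚ.+-assoc (toℕ d) i j) ⟩
    (toℕ d ℕ.+ (i ℕ.+ j)) % n       ≡⟨ toℕ-⊕ d (i ℕ.+ j) ⟨
    toℕ (d ⊕ (i ℕ.+ j)) ∎)

  ⊕-0 : ∀ (d : Fin n) → d ⊕ 0 ≡ d
  ⊕-0 d = Finₚ.toℕ-injective (trans (toℕ-⊕ d 0) (trans (cong (_% n) (ℕₚ.+-identityʳ (toℕ d))) (toℕ%n d)))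

  ⊕-n : ∀ (d : Fin n) → d ⊕ n ≡ d
  ⊕-n d = Finₚ.toℕ-injective (trans (toℕ-⊕ d n) (trans ([m+n]%n≡m%n (toℕ d) n) (toℕ%n d)))

  next-⊕ : ∀ (d : Fin n) j → next d ⊕ j ≡ d ⊕ suc j
  next-⊕ d = ⊕-⊕ d 1

  ⊕-suc : ∀ (d : Fin n) j → next (d ⊕ j) ≡ d ⊕ suc j
  ⊕-suc d j = trans (⊕-⊕ d j 1) (cong (d ⊕_) (ℕₚ.+-comm j 1))

  ⊕-pred-n : ∀ (d : Fin n) → d ⊕ suc (n ∸ 1) ≡ d
  ⊕-pred-n d = trans (cong (d ⊕_) (ℕₚ.suc-pred n)) (⊕-n d)

  prev-next : ∀ (i : Fin n) → prev (next i) ≡ i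
  prev-next i = trans (next-⊕ i (n ∸ 1)) (⊕-pred-n i)

  next-prev : ∀ (i : Fin n) → next (prev i) ≡ i
  next-prev i = trans (⊕-suc i (n ∸ 1)) (⊕-pred-n i)

  prev-injective : ∀ {i j : Fin n} → prev i ≡ prev j → i ≡ j
  prev-injective {i} {j} eq = trans (sym (next-prev i)) (trans (cong next eq) (next-prev j))

  xorSum-rotate : ∀ (f : Fin n → Bool) → xorSum (f ∘ next) ≡ xorSum f
  xorSum-rotate f = sym (xorSum-permute f (Perm.permutation next prev next-prev prev-next))

  -- the number of steps from d to k around the cycle
  offset : Fin n → Fin n → ℕ
  offset d k = (toℕ k ℕ.+ (n ∸ toℕ d)) % n

  offset<n : ∀ d k → offset d k < n
  offset<n d k = m%n<n _ n

  ⊕-offset : ∀ (d k : Fin n) → d ⊕ offset d k ≡ k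
  ⊕-offset d k = Finₚ.toℕ-injective (begin
    toℕ (d ⊕ offset d k)                         ≡⟨ toℕ-⊕ d (offset d k) ⟩
    (toℕ d ℕ.+ (toℕ k ℕ.+ (n ∸ toℕ d)) % n) % n  ≡⟨ %n-+ʳ (toℕ d) _ ⟩
    (toℕ d ℕ.+ (toℕ k ℕ.+ (n ∸ toℕ d))) % n      ≡⟨ cong (_% n) (x+[y+z]≡y+[x+z] (toℕ d) (toℕ k) _) ⟩
    (toℕ k ℕ.+ (toℕ d ℕ.+ (n ∸ toℕ d))) % n      ≡⟨ cong (λ r → (toℕ k ℕ.+ r) % n) (ℕₚ.m+[n∸m]≡n (ℕₚ.<⇒≤ (Finₚ.toℕ<n d))) ⟩
    (toℕ k ℕ.+ n) % n                            ≡⟨ [m+n]%n≡m%n (toℕ k) n ⟩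
    toℕ k % n                                    ≡⟨ toℕ%n k ⟩
    toℕ k ∎)

  offset-⊕ : ∀ (d : Fin n) j → j < n → offset d (d ⊕ j) ≡ j
  offset-⊕ d j j<n = begin
    (toℕ (d ⊕ j) ℕ.+ (n ∸ toℕ d)) % n           ≡⟨ cong (λ r → (r ℕ.+ (n ∸ toℕ d)) % n) (toℕ-⊕ d j) ⟩
    ((toℕ d ℕ.+ j) % n ℕ.+ (n ∸ toℕ d)) % n     ≡⟨ %n-+ˡ _ _ ⟩
    (toℕ d ℕ.+ j ℕ.+ (n ∸ toℕ d)) % n           ≡⟨ cong (_% n) (ℕₚ.+-assoc (toℕ d) j _) ⟩
    (toℕ d ℕ.+ (j ℕ.+ (n ∸ toℕ d))) % n         ≡⟨ cong (_% n) (x+[y+z]≡y+[x+z] (toℕ d) j _) ⟩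
    (j ℕ.+ (toℕ d ℕ.+ (n ∸ toℕ d))) % n         ≡⟨ cong (λ r → (j ℕ.+ r) % n) (ℕₚ.m+[n∸m]≡n (ℕₚ.<⇒≤ (Finₚ.toℕ<n d))) ⟩
    (j ℕ.+ n) % n                               ≡⟨ [m+n]%n≡m%n j n ⟩
    j % n                                       ≡⟨ m<n⇒m%n≡m j<n ⟩
    j ∎

module _ {n : ℕ} .{{_ : NonZero n}} where

  -- The telescoping identity and adapted T

  ha-sum : ℕ → Subset n → Subset n → (Fin n → ℤ) → Fin n → ℤ
  ha-sum p R S c j = sumFin (λ i → c i * ha p R S i j)

  β : Subset n → Subset n → Subset n → Fin n → ℤ
  β R S T j = δ R j * δ T j + δ S (next j) * δ T (next j)

  β-sign-xor : ∀ R S T j →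
    β R S T j ≡ sign (lookup R j xor lookup T j) + sign (lookup S (next j) xor lookup T (next j))
  β-sign-xor R S T j = cong₂ _+_
    (trans (cong₂ _*_ (δ-sign R j) (δ-sign T j)) (sign-xor (lookup R j) (lookup T j)))
    (trans (cong₂ _*_ (δ-sign S (next j)) (δ-sign T (next j))) (sign-xor (lookup S (next j)) (lookup T (next j))))

  e-prev : ∀ (i j : Fin n) → e (prev i) j ≡ e i (next j)
  e-prev i j with prev i Fin.≟ j | i Fin.≟ next j
  ... | yes _ | yes _ = refl
  ... | no  _ | no  _ = refl
  ... | yes prev-i≡j | no  i≢next-j = ⊥-elim (i≢next-j (trans (sym (next-prev i)) (cong next prev-i≡j)))
  ... | no  prev-i≢j | yes i≡next-j = ⊥-elim (prev-i≢j (trans (cong prev i≡next-j) (prev-next j)))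

  ha-sum-≡ : ∀ p R S (c : Fin n → ℤ) j → ha-sum p R S c j ≡ - (δ S j * c j) - + p * (δ R j * c (next j))
  ha-sum-≡ p R S c j = begin
    sumFin (λ i → c i * ha p R S i j)
      ≡⟨ sumFin-cong (λ i → trans (split (c i) (δ S i) (δ R (prev i)) (+ p) (e i j) (e (prev i) j))
                                   (cong (λ z → a i * e i j + b i * z) (e-prev i j))) ⟩
    sumFin (λ i → a i * e i j + b i * e i (next j))
      ≡⟨ sumFin-distrib-+ (λ i → a i * e i j) (λ i → b i * e i (next j)) ⟩
    sumFin (λ i → a i * e i j) + sumFin (λ i → b i * e i (next j))
      ≡⟨ cong₂ _+_ (sumFin-*e a j) (sumFin-*e b (next j)) ⟩
    - (c j * δ S j) + - (+ p * (c (next j) * δ R (prev (next j))))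
      ≡⟨ cong (λ i → - (c j * δ S j) + - (+ p * (c (next j) * δ R i))) (prev-next j) ⟩
    - (c j * δ S j) + - (+ p * (c (next j) * δ R j))
      ≡⟨ reorder (c j) (δ S j) (c (next j)) (δ R j) (+ p) ⟩
    - (δ S j * c j) - + p * (δ R j * c (next j)) ∎
    where
    a b : Fin n → ℤ
    a i = - (c i * δ S i)
    b i = - (+ p * (c i * δ R (prev i)))
    split : ∀ (c s r q e₁ e₂ : ℤ) → c * (- (s * e₁) + - (q * (r * e₂))) ≡ - (c * s) * e₁ + - (q * (c * r)) * e₂
    split = solve-∀
    reorder : ∀ (c s c′ r q : ℤ) → - (c * s) + - (q * (c′ * r)) ≡ - (s * c) - q * (r * c′)
    reorder = solve-∀

  F-cong : ∀ p T d {x y : Fin n → ℤ} → (∀ j → x j ≡ y j) → F p T d x ≡ F p T d y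
  F-cong p T d x≗y = sumℕ<-cong n (λ k _ → cong (λ z → + (p ^ k) * (δ T (d ⊕ k) * z)) (x≗y (d ⊕ k)))

  F-cong-lookup : ∀ p {T T′ : Subset n} d x → (∀ k → lookup T k ≡ lookup T′ k) → F p T d x ≡ F p T′ d x
  F-cong-lookup p {T} {T′} d x T≗T′ = sumℕ<-cong n (λ k _ → cong (λ z → + (p ^ k) * (z * x (d ⊕ k)))
    (trans (δ-sign T (d ⊕ k)) (trans (cong sign (T≗T′ (d ⊕ k))) (sym (δ-sign T′ (d ⊕ k))))))

  F-*ˡ : ∀ p T d (a : ℤ) x → F p T d (λ j → a * x j) ≡ a * F p T d x
  F-*ˡ p T d a x = trans (sumℕ<-cong n (λ k _ → swap (+ (p ^ k)) (δ T (d ⊕ k)) a (x (d ⊕ k)))) (sumℕ<-*ˡ n a _)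
    where
    swap : ∀ (q s a y : ℤ) → q * (s * (a * y)) ≡ a * (q * (s * y))
    swap = solve-∀

  F-next : ∀ p T (d : Fin n) x → + p * F p T (next d) x ≡ F p T d x + (+ (p ^ n) - 1ℤ) * (δ T d * x d)
  F-next p T d x = begin
    + p * F p T (next d) x
      ≡⟨ cong (+ p *_) (sumℕ<-cong n (λ k _ → cong (λ i → + (p ^ k) * (δ T i * x i)) (next-⊕ d k))) ⟩
    + p * sumℕ< n (λ k → + (p ^ k) * h (suc k))
      ≡⟨ sumℕ<-powers-shift p n h ⟩
    F p T d x - h 0 + + (p ^ n) * h n
      ≡⟨ cong₂ (λ a b → F p T d x - a + + (p ^ n) * b) (cong h′ (⊕-0 d)) (cong h′ (⊕-n d)) ⟩
    F p T d x - h′ d + + (p ^ n) * h′ d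
      ≡⟨ collect (F p T d x) (h′ d) (+ (p ^ n)) ⟩
    F p T d x + (+ (p ^ n) - 1ℤ) * (δ T d * x d) ∎
    where
    h′ : Fin n → ℤ
    h′ i = δ T i * x i
    h : ℕ → ℤ
    h k = h′ (d ⊕ k)
    collect : ∀ (f g q : ℤ) → f - g + q * g ≡ f + (q - 1ℤ) * g
    collect = solve-∀

  δ*ha-sum : ∀ p R S T (c : Fin n → ℤ) j →
    δ T j * ha-sum p R S c j ≡
    - (δ S j * δ T j * c j) + + p * (δ S (next j) * δ T (next j) * c (next j)) - + p * (β R S T j * c (next j))
  δ*ha-sum p R S T c j = trans (cong (δ T j *_) (ha-sum-≡ p R S c j))
    (expand (δ T j) (δ S j) (c j) (+ p) (δ R j) (c (next j)) (δ S (next j)) (δ T (next j)))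
    where
    expand : ∀ (t s c q r c′ s′ t′ : ℤ) →
      t * (- (s * c) - q * (r * c′)) ≡ - (s * t * c) + q * (s′ * t′ * c′) - q * ((r * t + s′ * t′) * c′)
    expand = solve-∀

  F-ha-sum : ∀ p R S T c (d : Fin n) →
    F p T d (ha-sum p R S c) ≡
    (+ (p ^ n) - 1ℤ) * (δ S d * δ T d * c d) - sumℕ< n (λ k → + (p ^ suc k) * (β R S T (d ⊕ k) * c (d ⊕ suc k)))
  F-ha-sum p R S T c d = begin
    sumℕ< n (λ k → + (p ^ k) * (δ T (d ⊕ k) * ha-sum p R S c (d ⊕ k)))
      ≡⟨ sumℕ<-cong n (λ k _ → term k) ⟩
    sumℕ< n (λ k → A k + - B k)
      ≡⟨ sumℕ<-distrib-+ n A (λ k → - B k) ⟩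
    sumℕ< n A + sumℕ< n (λ k → - B k)
      ≡⟨ cong₂ _+_ (sumℕ<-powers-telescope p n W) (sumℕ<-neg n B) ⟩
    + (p ^ n) * W n - W 0 - sumℕ< n B
      ≡⟨ cong₂ (λ a b → + (p ^ n) * a - b - sumℕ< n B) (cong w (⊕-n d)) (cong w (⊕-0 d)) ⟩
    + (p ^ n) * w d - w d - sumℕ< n B
      ≡⟨ cong (_- sumℕ< n B) (collect (+ (p ^ n)) (w d)) ⟩
    (+ (p ^ n) - 1ℤ) * w d - sumℕ< n B ∎
    where
    w : Fin n → ℤ
    w i = δ S i * δ T i * c i
    W A B : ℕ → ℤ
    W k = w (d ⊕ k)
    A k = + (p ^ k) * (- W k + + p * W (suc k))
    B k = + (p ^ suc k) * (β R S T (d ⊕ k) * c (d ⊕ suc k))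
    collect : ∀ (q w : ℤ) → q * w - w ≡ (q - 1ℤ) * w
    collect = solve-∀
    distribute : ∀ (q p a b x : ℤ) → q * (- a + p * b - p * x) ≡ q * (- a + p * b) + - ((p * q) * x)
    distribute = solve-∀
    term : ∀ k → + (p ^ k) * (δ T (d ⊕ k) * ha-sum p R S c (d ⊕ k)) ≡ A k + - B k
    term k = begin
      + (p ^ k) * (δ T (d ⊕ k) * ha-sum p R S c (d ⊕ k))
        ≡⟨ cong (+ (p ^ k) *_) (δ*ha-sum p R S T c (d ⊕ k)) ⟩
      + (p ^ k) * (- W k + + p * w (next (d ⊕ k)) - + p * (β R S T (d ⊕ k) * c (next (d ⊕ k))))
        ≡⟨ cong (λ i → + (p ^ k) * (- W k + + p * w i - + p * (β R S T (d ⊕ k) * c i))) (⊕-suc d k) ⟩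
      + (p ^ k) * (- W k + + p * W (suc k) - + p * (β R S T (d ⊕ k) * c (d ⊕ suc k)))
        ≡⟨ distribute (+ (p ^ k)) (+ p) (W k) (W (suc k)) _ ⟩
      A k + - (+ p * + (p ^ k) * (β R S T (d ⊕ k) * c (d ⊕ suc k)))
        ≡⟨ cong (λ q → A k + - (q * (β R S T (d ⊕ k) * c (d ⊕ suc k)))) (ℤₚ.pos-* p (p ^ k)) ⟨
      A k + - B k ∎

  F-ha-sum-balanced : ∀ p R S T c (d : Fin n) → (∀ j → β R S T j ≡ 0ℤ) →
    F p T d (ha-sum p R S c) ≡ (+ (p ^ n) - 1ℤ) * (δ S d * δ T d * c d)
  F-ha-sum-balanced p R S T c d β≡0 = begin
    F p T d (ha-sum p R S c)
      ≡⟨ F-ha-sum p R S T c d ⟩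
    (+ (p ^ n) - 1ℤ) * (δ S d * δ T d * c d) - sumℕ< n (λ k → + (p ^ suc k) * (β R S T (d ⊕ k) * c (d ⊕ suc k)))
      ≡⟨ cong (λ s → (+ (p ^ n) - 1ℤ) * (δ S d * δ T d * c d) - s)
              (trans (sumℕ<-cong n (λ k _ → vanish (+ (p ^ suc k)) (c (d ⊕ suc k)) (β≡0 (d ⊕ k)))) (sumℕ<-zero n)) ⟩
    (+ (p ^ n) - 1ℤ) * (δ S d * δ T d * c d) - 0ℤ
      ≡⟨ ℤₚ.+-identityʳ _ ⟩
    (+ (p ^ n) - 1ℤ) * (δ S d * δ T d * c d) ∎
    where
    vanish : ∀ (q c : ℤ) {b} → b ≡ 0ℤ → q * (b * c) ≡ 0ℤ
    vanish q c refl = trans (cong (q *_) (ℤₚ.*-zeroˡ c)) (ℤₚ.*-zeroʳ q)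

  δ-square : ∀ (X : Subset n) j → δ X j * δ X j ≡ 1ℤ
  δ-square X j = trans (cong₂ _*_ (δ-sign X j) (δ-sign X j)) (sign-square (lookup X j))

  δ-true : ∀ {X : Subset n} {j} → lookup X j ≡ true → δ X j ≡ - 1ℤ
  δ-true {X} {j} eq = trans (δ-sign X j) (cong sign eq)

  δ-false : ∀ {X : Subset n} {j} → lookup X j ≡ false → δ X j ≡ 1ℤ
  δ-false {X} {j} eq = trans (δ-sign X j) (cong sign eq)

  ha-sum-of-F : ∀ p R S T x → (∀ j → β R S T j ≡ 0ℤ) → ∀ j →
    ha-sum p R S (λ i → δ S i * δ T i * F p T i x) j ≡ (+ (p ^ n) - 1ℤ) * x j
  ha-sum-of-F p R S T x β≡0 j = begin
    ha-sum p R S (λ i → δ S i * δ T i * F p T i x) j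
      ≡⟨ ha-sum-≡ p R S (λ i → δ S i * δ T i * F p T i x) j ⟩
    - (s * (s * t * Fj)) - + p * (r * (s′ * t′ * F′))
      ≡⟨ cong (λ u → - (s * (s * t * Fj)) - + p * (r * (u * F′))) s′t′≡-rt ⟩
    - (s * (s * t * Fj)) - + p * (r * (- (r * t) * F′))
      ≡⟨ regroup s t Fj (+ p) r F′ ⟩
    - ((s * s) * (t * Fj)) + (r * r) * (t * (+ p * F′))
      ≡⟨ cong₂ (λ u v → - (u * (t * Fj)) + v * (t * (+ p * F′))) (δ-square S j) (δ-square R j) ⟩
    - (1ℤ * (t * Fj)) + 1ℤ * (t * (+ p * F′))
      ≡⟨ cong (λ u → - (1ℤ * (t * Fj)) + 1ℤ * (t * u)) (F-next p T j x) ⟩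
    - (1ℤ * (t * Fj)) + 1ℤ * (t * (Fj + (+ (p ^ n) - 1ℤ) * (t * x j)))
      ≡⟨ cancel t Fj (+ (p ^ n)) (x j) ⟩
    (+ (p ^ n) - 1ℤ) * ((t * t) * x j)
      ≡⟨ cong (λ u → (+ (p ^ n) - 1ℤ) * (u * x j)) (δ-square T j) ⟩
    (+ (p ^ n) - 1ℤ) * (1ℤ * x j)
      ≡⟨ cong ((+ (p ^ n) - 1ℤ) *_) (ℤₚ.*-identityˡ (x j)) ⟩
    (+ (p ^ n) - 1ℤ) * x j ∎
    where
    s = δ S j
    t = δ T j
    r = δ R j
    s′ = δ S (next j)
    t′ = δ T (next j)
    Fj = F p T j x
    F′ = F p T (next j) x
    s′t′≡-rt : s′ * t′ ≡ - (r * t)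
    s′t′≡-rt = +-inverseʳ-unique (r * t) (s′ * t′) (β≡0 j)
    regroup : ∀ (s t f q r f′ : ℤ) → - (s * (s * t * f)) - q * (r * (- (r * t) * f′)) ≡ - ((s * s) * (t * f)) + (r * r) * (t * (q * f′))
    regroup = solve-∀
    cancel : ∀ (t f P y : ℤ) → - (1ℤ * (t * f)) + 1ℤ * (t * (f + (P - 1ℤ) * (t * y))) ≡ (P - 1ℤ) * ((t * t) * y)
    cancel = solve-∀

  record Adapted (R S T : Subset n) : Set where
    constructor adapted
    field
      β≡0      : ∀ j → β R S T j ≡ 0ℤ
      disjoint : ∀ s → lookup S s ≡ true → lookup T s ≡ false

  Adapted⇒C-pHa⇔HomCone : ∀ p → 2 ≤ p → ∀ R S T → Adapted R S T → ∀ x → C-pHa p R S x ⇔ HomCone p T S x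
  Adapted⇒C-pHa⇔HomCone p 2≤p R S T (adapted β≡0 T∩S≡∅) x = mk⇔ to from
    where
    P = p ^ n
    2≤P : 2 ≤ P
    2≤P = 2≤p^n p n 2≤p
    to : C-pHa p R S x → HomCone p T S x
    to (m , 1≤m , c , c≥0 , mx≡) d d∈S with F p T d x ℤ.≤? 0ℤ
    ... | yes F≤0 = F≤0
    ... | no  F≰0 = ⊥-elim (sign-mismatch false m P (F p T d x) (c d) 1≤m 2≤P (c≥0 d d∈S)
                       (subst (0ℤ ℤ.<_) (sym (ℤₚ.*-identityˡ _)) (ℤₚ.≰⇒> F≰0)) mF≡)
      where
      collect : ∀ (Q c : ℤ) → (Q - 1ℤ) * (- 1ℤ * 1ℤ * c) ≡ c * (1ℤ - Q * 1ℤ)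
      collect = solve-∀
      mF≡ : + m * F p T d x ≡ c d * (1ℤ - + P * 1ℤ)
      mF≡ = begin
        + m * F p T d x                           ≡⟨ F-*ˡ p T d (+ m) x ⟨
        F p T d (λ j → + m * x j)                 ≡⟨ F-cong p T d mx≡ ⟩
        F p T d (ha-sum p R S c)                  ≡⟨ F-ha-sum-balanced p R S T c d β≡0 ⟩
        (+ P - 1ℤ) * (δ S d * δ T d * c d)        ≡⟨ cong₂ (λ u v → (+ P - 1ℤ) * (u * v * c d))
                                                       (δ-true {S} {d} (∈⇒lookup d∈S)) (δ-false {T} {d} (T∩S≡∅ d (∈⇒lookup d∈S))) ⟩
        (+ P - 1ℤ) * (- 1ℤ * 1ℤ * c d)            ≡⟨ collect (+ P) (c d) ⟩
        c d * (1ℤ - + P * 1ℤ) ∎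
    from : HomCone p T S x → C-pHa p R S x
    from x∈cone = P ∸ 1 , ℕₚ.≤-pred (subst (2 ≤_) (sym (ℕₚ.suc-pred P {{ℕ.>-nonZero (ℕₚ.<-trans (s≤s z≤n) 2≤P)}})) 2≤P) , c , c≥0 ,
      λ j → trans (cong (_* x j) (+[m∸1]≡+m-1 (ℕₚ.<⇒≤ 2≤P))) (sym (ha-sum-of-F p R S T x β≡0 j))
      where
      c : Fin n → ℤ
      c i = δ S i * δ T i * F p T i x
      c≥0 : ∀ i → i ∈ S → 0ℤ ℤ.≤ c i
      c≥0 i i∈S = subst (0ℤ ℤ.≤_) (sym c≡-F) (ℤₚ.neg-mono-≤ (x∈cone i i∈S))
        where
        c≡-F : c i ≡ - F p T i x
        c≡-F = trans (cong₂ (λ u v → u * v * F p T i x) (δ-true {S} {i} (∈⇒lookup i∈S)) (δ-false {T} {i} (T∩S≡∅ i (∈⇒lookup i∈S))))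
                     (ℤₚ.-1*i≡-i _)


  -- Homogeneous cones come from adapted T

  β≡0⇔ : ∀ R S T (j : Fin n) →
    β R S T j ≡ 0ℤ ⇔ (lookup S (next j) xor lookup T (next j) ≡ not (lookup R j xor lookup T j))
  β≡0⇔ R S T j = mk⇔ (λ β≡0 → Equivalence.to (sign+sign≡0⇔ _ _) (trans (sym (β-sign-xor R S T j)) β≡0))
                     (λ eq → trans (β-sign-xor R S T j) (Equivalence.from (sign+sign≡0⇔ _ _) eq))

  β-xor : ∀ R S {T V : Subset n} b → (∀ k → lookup T k ≡ b xor lookup V k) → ∀ j → β R S T j ≡ sign b * β R S V j
  β-xor R S {T} {V} b T≡b⊕V j = begin
    δ R j * δ T j + δ S (next j) * δ T (next j)
      ≡⟨ cong₂ (λ u v → δ R j * u + δ S (next j) * v) (δT j) (δT (next j)) ⟩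
    δ R j * (sign b * δ V j) + δ S (next j) * (sign b * δ V (next j))
      ≡⟨ factor (δ R j) (sign b) (δ V j) (δ S (next j)) (δ V (next j)) ⟩
    sign b * β R S V j ∎
    where
    δT : ∀ i → δ T i ≡ sign b * δ V i
    δT i = trans (δ-sign T i) (trans (cong sign (T≡b⊕V i)) (trans (sym (sign-xor b (lookup V i))) (cong (sign b *_) (sym (δ-sign V i)))))
    factor : ∀ (r b v s v′ : ℤ) → r * (b * v) + s * (b * v′) ≡ b * (r * v + s * v′)
    factor = solve-∀

  e-refl : ∀ (k : Fin n) → e k k ≡ 1ℤ
  e-refl k with k Fin.≟ k
  ... | yes _ = refl
  ... | no k≢k = ⊥-elim (k≢k refl)

  e-≢ : ∀ {k j : Fin n} → k ≢ j → e k j ≡ 0ℤ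
  e-≢ {k} {j} k≢j with k Fin.≟ j
  ... | yes k≡j = ⊥-elim (k≢j k≡j)
  ... | no  _   = refl

  F-e : ∀ p V (d k : Fin n) a → F p V d (λ j → a * e k j) ≡ + (p ^ offset d k) * (δ V k * a)
  F-e p V d k a = begin
    F p V d (λ j → a * e k j)
      ≡⟨ sumℕ<-single n _ (offset d k) (offset<n d k) (λ j j<n j≢ → vanish j (λ k≡ → j≢ (trans (sym (offset-⊕ d j j<n)) (cong (offset d) (sym k≡))))) ⟩
    + (p ^ offset d k) * (δ V (d ⊕ offset d k) * (a * e k (d ⊕ offset d k)))
      ≡⟨ cong (λ i → + (p ^ offset d k) * (δ V i * (a * e k i))) (⊕-offset d k) ⟩
    + (p ^ offset d k) * (δ V k * (a * e k k))
      ≡⟨ cong (λ u → + (p ^ offset d k) * (δ V k * (a * u))) (e-refl k) ⟩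
    + (p ^ offset d k) * (δ V k * (a * 1ℤ))
      ≡⟨ cong (λ u → + (p ^ offset d k) * (δ V k * u)) (ℤₚ.*-identityʳ a) ⟩
    + (p ^ offset d k) * (δ V k * a) ∎
    where
    vanish : ∀ j → k ≢ d ⊕ j → + (p ^ j) * (δ V (d ⊕ j) * (a * e k (d ⊕ j))) ≡ 0ℤ
    vanish j k≢ = begin
      + (p ^ j) * (δ V (d ⊕ j) * (a * e k (d ⊕ j))) ≡⟨ cong (λ u → + (p ^ j) * (δ V (d ⊕ j) * (a * u))) (e-≢ k≢) ⟩
      + (p ^ j) * (δ V (d ⊕ j) * (a * 0ℤ))          ≡⟨ zero-out (+ (p ^ j)) (δ V (d ⊕ j)) a ⟩
      0ℤ ∎
      where
      zero-out : ∀ (q v a : ℤ) → q * (v * (a * 0ℤ)) ≡ 0ℤ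
      zero-out = solve-∀

  -- the signs forced by β = 0 along one turn of the cycle from d, starting from V d = false
  propagate-bits : Subset n → Subset n → Fin n → ℕ → Bool
  propagate-bits R S d zero    = false
  propagate-bits R S d (suc k) = lookup S (d ⊕ suc k) xor not (lookup R (d ⊕ k) xor propagate-bits R S d k)

  propagate : Subset n → Subset n → Fin n → Subset n
  propagate R S d = tabulate (propagate-bits R S d ∘ offset d)

  module _ (R S : Subset n) (d : Fin n) where
    private
      V = propagate R S d
      bits = propagate-bits R S d

    lookup-propagate : ∀ k → k < n → lookup V (d ⊕ k) ≡ bits k
    lookup-propagate k k<n = trans (lookup∘tabulate _ (d ⊕ k)) (cong bits (offset-⊕ d k k<n))

    propagate-start : lookup V d ≡ false
    propagate-start = trans (cong (lookup V) (sym (⊕-0 d))) (lookup-propagate 0 (ℕ.>-nonZero⁻¹ n))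

    β-propagate : ∀ k → suc k < n → β R S V (d ⊕ k) ≡ 0ℤ
    β-propagate k 1+k<n = Equivalence.from (β≡0⇔ R S V (d ⊕ k)) (begin
      lookup S (next (d ⊕ k)) xor lookup V (next (d ⊕ k))
        ≡⟨ cong (λ i → lookup S i xor lookup V i) (⊕-suc d k) ⟩
      lookup S (d ⊕ suc k) xor lookup V (d ⊕ suc k)
        ≡⟨ cong (lookup S (d ⊕ suc k) xor_) (lookup-propagate (suc k) 1+k<n) ⟩
      lookup S (d ⊕ suc k) xor (lookup S (d ⊕ suc k) xor not (lookup R (d ⊕ k) xor bits k))
        ≡⟨ xor-cancelˡ (lookup S (d ⊕ suc k)) _ ⟩
      not (lookup R (d ⊕ k) xor bits k)
        ≡⟨ cong (λ b → not (lookup R (d ⊕ k) xor b)) (lookup-propagate k (ℕₚ.<-trans (ℕₚ.n<1+n k) 1+k<n)) ⟨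
      not (lookup R (d ⊕ k) xor lookup V (d ⊕ k)) ∎)

    β-propagate-≢ : ∀ j → j ≢ prev d → β R S V j ≡ 0ℤ
    β-propagate-≢ j j≢prev-d = subst (λ i → β R S V i ≡ 0ℤ) (⊕-offset d j) (β-propagate (offset d j) 1+o<n)
      where
      o≢n∸1 : offset d j ≢ n ∸ 1
      o≢n∸1 o≡ = j≢prev-d (trans (sym (⊕-offset d j)) (cong (d ⊕_) o≡))
      1+o<n : suc (offset d j) < n
      1+o<n = subst (suc (offset d j) <_) (ℕₚ.suc-pred n)
                (s≤s (ℕₚ.≤∧≢⇒< (ℕₚ.≤-pred (subst (offset d j <_) (sym (ℕₚ.suc-pred n)) (offset<n d j))) o≢n∸1))

    β-propagate-prev : lookup S d ≡ true → β R S V (prev d) ≡ sign (lookup R (prev d) xor lookup V (prev d)) - 1ℤ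
    β-propagate-prev d∈S = begin
      β R S V (prev d)                                  ≡⟨ β-sign-xor R S V (prev d) ⟩
      σ + sign (lookup S (next (prev d)) xor lookup V (next (prev d)))
                                                        ≡⟨ cong (λ i → σ + sign (lookup S i xor lookup V i)) (next-prev d) ⟩
      σ + sign (lookup S d xor lookup V d)              ≡⟨ cong₂ (λ a b → σ + sign (a xor b)) d∈S propagate-start ⟩
      σ - 1ℤ ∎
      where
      σ = sign (lookup R (prev d) xor lookup V (prev d))

  F-ha-sum-one-defect : ∀ p R S V c (d : Fin n) → (∀ k → suc k < n → β R S V (d ⊕ k) ≡ 0ℤ) →
    F p V d (ha-sum p R S c) ≡ (+ (p ^ n) - 1ℤ) * (δ S d * δ V d * c d) - + (p ^ n) * (β R S V (prev d) * c d)
  F-ha-sum-one-defect p R S V c d β≡0 = begin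
    F p V d (ha-sum p R S c)
      ≡⟨ F-ha-sum p R S V c d ⟩
    (+ (p ^ n) - 1ℤ) * (δ S d * δ V d * c d) - sumℕ< n B
      ≡⟨ cong (λ s → (+ (p ^ n) - 1ℤ) * (δ S d * δ V d * c d) - s) (sumℕ<-last n B vanish) ⟩
    (+ (p ^ n) - 1ℤ) * (δ S d * δ V d * c d) - B (n ∸ 1)
      ≡⟨ cong (λ k → (+ (p ^ n) - 1ℤ) * (δ S d * δ V d * c d) - + (p ^ k) * (β R S V (prev d) * c (d ⊕ k))) (ℕₚ.suc-pred n) ⟩
    (+ (p ^ n) - 1ℤ) * (δ S d * δ V d * c d) - + (p ^ n) * (β R S V (prev d) * c (d ⊕ n))
      ≡⟨ cong (λ i → (+ (p ^ n) - 1ℤ) * (δ S d * δ V d * c d) - + (p ^ n) * (β R S V (prev d) * c i)) (⊕-n d) ⟩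
    (+ (p ^ n) - 1ℤ) * (δ S d * δ V d * c d) - + (p ^ n) * (β R S V (prev d) * c d) ∎
    where
    B : ℕ → ℤ
    B k = + (p ^ suc k) * (β R S V (d ⊕ k) * c (d ⊕ suc k))
    vanish : ∀ k → suc k < n → B k ≡ 0ℤ
    vanish k 1+k<n = trans (cong (λ b → + (p ^ suc k) * (b * c (d ⊕ suc k))) (β≡0 k 1+k<n))
                           (trans (cong (+ (p ^ suc k) *_) (ℤₚ.*-zeroˡ (c (d ⊕ suc k)))) (ℤₚ.*-zeroʳ (+ (p ^ suc k))))

  HomCone⊆C-pHa⇒β≡0 : ∀ p → 2 ≤ p → ∀ R S T → (∀ x → HomCone p T S x → C-pHa p R S x) →
    ∀ d → lookup S d ≡ true → ∀ j → j ≢ prev d → β R S T j ≡ 0ℤ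
  HomCone⊆C-pHa⇒β≡0 p 2≤p R S T cone⊆ d d∈S j j≢prev-d = begin
    β R S T j          ≡⟨ β-xor R S b T≡b⊕V j ⟩
    sign b * β R S V j ≡⟨ cong (sign b *_) (β-propagate-≢ R S d j j≢prev-d) ⟩
    sign b * 0ℤ        ≡⟨ ℤₚ.*-zeroʳ (sign b) ⟩
    0ℤ ∎
    where
    V = propagate R S d
    b = lookup R (prev d) xor lookup V (prev d)
    P = p ^ n
    -- −δ_T(k) e_k lies in the cone of T, but F^{(d)}_V of any representation of it has the wrong sign
    mismatch : ∀ k → lookup T k ≡ not (b xor lookup V k) → ⊥
    mismatch k Tk = refute (cone⊆ x x∈cone)
      where
      x : Fin n → ℤ
      x j = - δ T k * e k j
      F-x : ∀ U d′ → F p U d′ x ≡ + (p ^ offset d′ k) * (δ U k * - δ T k)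
      F-x U d′ = F-e p U d′ k (- δ T k)
      x∈cone : HomCone p T S x
      x∈cone d′ _ = subst (ℤ._≤ 0ℤ) (sym (trans (F-x T d′) F≡)) ℤₚ.neg-≤-pos
        where
        F≡ : + (p ^ offset d′ k) * (δ T k * - δ T k) ≡ - + (p ^ offset d′ k)
        F≡ = begin
          + (p ^ offset d′ k) * (δ T k * - δ T k)   ≡⟨ cong (+ (p ^ offset d′ k) *_) (ℤₚ.neg-distribʳ-* (δ T k) (δ T k)) ⟨
          + (p ^ offset d′ k) * - (δ T k * δ T k)   ≡⟨ cong (λ u → + (p ^ offset d′ k) * - u) (δ-square T k) ⟩
          + (p ^ offset d′ k) * - 1ℤ                ≡⟨ ℤₚ.*-comm (+ (p ^ offset d′ k)) (- 1ℤ) ⟩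
          - 1ℤ * + (p ^ offset d′ k)                ≡⟨ ℤₚ.-1*i≡-i _ ⟩
          - + (p ^ offset d′ k) ∎
      refute : C-pHa p R S x → ⊥
      refute (m , 1≤m , c , c≥0 , mx≡) = sign-mismatch b m P (F p V d x) (c d) 1≤m (2≤p^n p n 2≤p) (c≥0 d (lookup⇒∈ d∈S)) 0<bF mF≡
        where
        q = p ^ offset d k
        bF≡ : sign b * F p V d x ≡ + q
        bF≡ = begin
          sign b * F p V d x                                          ≡⟨ cong (sign b *_) (F-x V d) ⟩
          sign b * (+ q * (δ V k * - δ T k))                          ≡⟨ cong₂ (λ u v → sign b * (+ q * (u * - v))) (δ-sign V k) (trans (δ-sign T k) (cong sign Tk)) ⟩
          sign b * (+ q * (sign (lookup V k) * - sign (not (b xor lookup V k))))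
                                                                      ≡⟨ swap (sign b) (+ q) _ ⟩
          + q * (sign b * (sign (lookup V k) * - sign (not (b xor lookup V k))))
                                                                      ≡⟨ cong (+ q *_) (sign-xor-not b (lookup V k)) ⟩
          + q * 1ℤ                                                    ≡⟨ ℤₚ.*-identityʳ (+ q) ⟩
          + q ∎
          where
          swap : ∀ (s q w : ℤ) → s * (q * w) ≡ q * (s * w)
          swap = solve-∀
        0<bF : 0ℤ ℤ.< sign b * F p V d x
        0<bF = subst (0ℤ ℤ.<_) (sym bF≡) (ℤ.+<+ (ℕₚ.m^n>0 p {{ℕ.>-nonZero (ℕₚ.<-trans (s≤s z≤n) 2≤p)}} (offset d k)))
        mF≡ : + m * F p V d x ≡ c d * (1ℤ - + P * sign b)
        mF≡ = begin
          + m * F p V d x                                                      ≡⟨ F-*ˡ p V d (+ m) x ⟨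
          F p V d (λ j → + m * x j)                                            ≡⟨ F-cong p V d mx≡ ⟩
          F p V d (ha-sum p R S c)                                             ≡⟨ F-ha-sum-one-defect p R S V c d (β-propagate R S d) ⟩
          (+ P - 1ℤ) * (δ S d * δ V d * c d) - + P * (β R S V (prev d) * c d)
            ≡⟨ cong₃ (δ-true {X = S} {j = d} d∈S) (δ-false {X = V} {j = d} (propagate-start R S d)) (β-propagate-prev R S d d∈S) ⟩
          (+ P - 1ℤ) * (- 1ℤ * 1ℤ * c d) - + P * ((sign b - 1ℤ) * c d)        ≡⟨ collect (+ P) (c d) (sign b) ⟩
          c d * (1ℤ - + P * sign b) ∎
          where
          cong₃ : ∀ {s s′ v v′ w w′} → s ≡ s′ → v ≡ v′ → w ≡ w′ →
                  (+ P - 1ℤ) * (s * v * c d) - + P * (w * c d) ≡ (+ P - 1ℤ) * (s′ * v′ * c d) - + P * (w′ * c d)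
          cong₃ refl refl refl = refl
          collect : ∀ (P c σ : ℤ) → (P - 1ℤ) * (- 1ℤ * 1ℤ * c) - P * ((σ - 1ℤ) * c) ≡ c * (1ℤ - P * σ)
          collect = solve-∀
    T≡b⊕V : ∀ k → lookup T k ≡ b xor lookup V k
    T≡b⊕V k with lookup T k Boolₚ.≟ (b xor lookup V k)
    ... | yes eq = eq
    ... | no  ne = ⊥-elim (mismatch k (≢⇒≡not ne))
      where
      ≢⇒≡not : ∀ {a c} → a ≢ c → a ≡ not c
      ≢⇒≡not {true}  {true}  ne = ⊥-elim (ne refl)
      ≢⇒≡not {true}  {false} _  = refl
      ≢⇒≡not {false} {true}  _  = refl
      ≢⇒≡not {false} {false} ne = ⊥-elim (ne refl)

  e-nonNeg : ∀ (i j : Fin n) → 0ℤ ℤ.≤ e i j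
  e-nonNeg i j with i Fin.≟ j
  ... | yes _ = ℤ.+≤+ z≤n
  ... | no  _ = ℤ.+≤+ z≤n

  ha∈C-pHa : ∀ p R S (s : Fin n) → C-pHa p R S (ha p R S s)
  ha∈C-pHa p R S s = 1 , ℕₚ.≤-refl , e s , (λ i _ → e-nonNeg s i) ,
    λ j → trans (ℤₚ.*-identityˡ _) (sym (sumFin-e* (λ i → ha p R S i j) s))

  homogeneous⇒Adapted : ∀ p → 2 ≤ p → ∀ R S T {s₁ s₂ : Fin n} → s₁ ≢ s₂ → lookup S s₁ ≡ true → lookup S s₂ ≡ true →
    (∀ x → C-pHa p R S x ⇔ HomCone p T S x) → Adapted R S T
  homogeneous⇒Adapted p 2≤p R S T {s₁} {s₂} s₁≢s₂ s₁∈S s₂∈S C≡cone = adapted β≡0 T∩S≡∅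
    where
    cone⊆ : ∀ x → HomCone p T S x → C-pHa p R S x
    cone⊆ x = Equivalence.from (C≡cone x)
    β≡0 : ∀ j → β R S T j ≡ 0ℤ
    β≡0 j with j Fin.≟ prev s₁
    ... | no  j≢prev-s₁ = HomCone⊆C-pHa⇒β≡0 p 2≤p R S T cone⊆ s₁ s₁∈S j j≢prev-s₁
    ... | yes refl      = HomCone⊆C-pHa⇒β≡0 p 2≤p R S T cone⊆ s₂ s₂∈S j (s₁≢s₂ ∘ prev-injective)
    P = p ^ n
    2≤P : 2 ≤ P
    2≤P = 2≤p^n p n 2≤p
    T∩S≡∅ : ∀ s → lookup S s ≡ true → lookup T s ≡ false
    T∩S≡∅ s s∈S with lookup T s in s∈T
    ... | false = refl
    ... | true  = ⊥-elim (ℤₚ.<⇒≱ 0<F (Equivalence.to (C≡cone _) (ha∈C-pHa p R S s) s (lookup⇒∈ s∈S)))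
      where
      F≡ : F p T s (ha p R S s) ≡ + P - 1ℤ
      F≡ = begin
        F p T s (ha p R S s)                    ≡⟨ F-cong p T s (λ j → sym (sumFin-e* (λ i → ha p R S i j) s)) ⟩
        F p T s (ha-sum p R S (e s))            ≡⟨ F-ha-sum-balanced p R S T (e s) s β≡0 ⟩
        (+ P - 1ℤ) * (δ S s * δ T s * e s s)    ≡⟨ cong₂ (λ u v → (+ P - 1ℤ) * (u * v * e s s)) (δ-true {X = S} s∈S) (δ-true {X = T} s∈T) ⟩
        (+ P - 1ℤ) * (1ℤ * e s s)               ≡⟨ cong (λ u → (+ P - 1ℤ) * (1ℤ * u)) (e-refl s) ⟩
        (+ P - 1ℤ) * (1ℤ * 1ℤ)                  ≡⟨ ℤₚ.*-identityʳ _ ⟩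
        + P - 1ℤ ∎
      0<F : 0ℤ ℤ.< F p T s (ha p R S s)
      0<F = subst (0ℤ ℤ.<_) (sym (trans F≡ (sym (+[m∸1]≡+m-1 (ℕₚ.<⇒≤ 2≤P))))) (ℤ.+<+ (ℕₚ.∸-monoˡ-< {1} {1} 2≤P ℕₚ.≤-refl))

  -- Arcs and components of the chain diagram

  iterate : (Fin n → Fin n) → ℕ → Fin n → Fin n
  iterate g zero    k = k
  iterate g (suc j) k = iterate g j (g k)

  Reaches : (Fin n → Fin n) → (Fin n → Bool) → Set
  Reaches g stop = ∀ k → Σ ℕ λ j → j < n × stop (iterate g j k) ≡ true

  module Walk {A : Set} (g : Fin n → Fin n) (stop : Fin n → Bool) (base : Fin n → A) (step : Fin n → A → A) where

    walk : ℕ → Fin n → A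
    walk zero    k = base k
    walk (suc f) k = if stop k then base k else step k (walk f (g k))

    walk-stable : ∀ j k → stop (iterate g j k) ≡ true → ∀ f → j ≤ f → walk f k ≡ walk j k
    walk-stable zero    k stops zero    _   = refl
    walk-stable zero    k stops (suc f) _   rewrite stops = refl
    walk-stable (suc j) k stops (suc f) j≤f with stop k
    ... | true  = refl
    ... | false = cong (step k) (walk-stable j (g k) stops f (ℕₚ.≤-pred j≤f))

    walk-stop : ∀ k → stop k ≡ true → walk n k ≡ base k
    walk-stop k stops = subst (λ f → walk f k ≡ base k) (ℕₚ.suc-pred n) (stopped stops)
      where
      stopped : stop k ≡ true → walk (suc (n ∸ 1)) k ≡ base k
      stopped stops rewrite stops = refl

    walk-step : Reaches g stop → ∀ k → stop k ≡ false → walk n k ≡ step k (walk n (g k))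
    walk-step reaches k goes = subst (λ f → walk f k ≡ step k (walk n (g k))) (ℕₚ.suc-pred n)
      (trans (moved goes) (cong (step k) (trans (walk-stable j (g k) stops (n ∸ 1) j≤n∸1) (sym (walk-stable j (g k) stops n (ℕₚ.<⇒≤ j<n))))))
      where
      j = proj₁ (reaches (g k))
      j<n = proj₁ (proj₂ (reaches (g k)))
      stops = proj₂ (proj₂ (reaches (g k)))
      j≤n∸1 : j ≤ n ∸ 1
      j≤n∸1 = ℕₚ.≤-pred (subst (j <_) (sym (ℕₚ.suc-pred n)) j<n)
      moved : stop k ≡ false → walk (suc (n ∸ 1)) k ≡ step k (walk (n ∸ 1) (g k))
      moved goes rewrite goes = refl

  module Find (g : Fin n → Fin n) (stop : Fin n → Bool) where
    open Walk g stop (λ k → k) (λ _ v → v) public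

    walk-stops : ∀ j k → stop (iterate g j k) ≡ true → ∀ f → j ≤ f → stop (walk f k) ≡ true
    walk-stops zero    k stops zero    _   = stops
    walk-stops zero    k stops (suc f) _   rewrite stops = stops
    walk-stops (suc j) k stops (suc f) j≤f with stop k in eq
    ... | true  = eq
    ... | false = walk-stops j (g k) stops f (ℕₚ.≤-pred j≤f)

    find : Fin n → Fin n
    find = walk n

    find-stops : Reaches g stop → ∀ k → stop (find k) ≡ true
    find-stops reaches k = walk-stops _ k (proj₂ (proj₂ (reaches k))) n (ℕₚ.<⇒≤ (proj₁ (proj₂ (reaches k))))

  edge-sym : ∀ {S : Subset n} {i j} → Edge S i j → Edge S j i
  edge-sym (inj₁ e) = inj₂ e
  edge-sym (inj₂ e) = inj₁ e

  path-invariant : ∀ {A : Set} {S : Subset n} (φ : Fin n → A) → (∀ k → lookup S (next k) ≡ false → φ k ≡ φ (next k)) →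
    ∀ {i j} → Connected S i j → φ i ≡ φ j
  path-invariant φ inv ε                          = refl
  path-invariant φ inv (inj₁ (refl , ∉S) ◅ path) = trans (inv _ (∉⇒lookup ∉S)) (path-invariant φ inv path)
  path-invariant φ inv (inj₂ (refl , ∉S) ◅ path) = trans (sym (inv _ (∉⇒lookup ∉S))) (path-invariant φ inv path)

  path-closed : ∀ {S : Subset n} (C : Subset n) → (∀ i j → i ∈ C → Edge S i j → j ∈ C) → ∀ {i j} → Connected S i j → i ∈ C → j ∈ C
  path-closed C closed ε              i∈C = i∈C
  path-closed C closed (edge ◅ path) i∈C = path-closed C closed path (closed _ _ i∈C edge)

  record ArcRules (R S T : Subset n) : Set where
    constructor arcRules
    field
      at-end : ∀ k → lookup S (next k) ≡ true → lookup T k ≡ lookup R k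
      along  : ∀ k → lookup S (next k) ≡ false → lookup T (next k) ≡ not (lookup R k xor lookup T k)

  Adapted⇒ArcRules : ∀ {R S T} → Adapted R S T → ArcRules R S T
  Adapted⇒ArcRules {R} {S} {T} (adapted β≡0 disjoint) = arcRules at-end along
    where
    at-end : ∀ k → lookup S (next k) ≡ true → lookup T k ≡ lookup R k
    at-end k next-k∈S = true≡not-xor⇒≡ (subst₂ (λ a b → a xor b ≡ not (lookup R k xor lookup T k)) next-k∈S (disjoint (next k) next-k∈S)
                                         (Equivalence.to (β≡0⇔ R S T k) (β≡0 k)))
      where
      true≡not-xor⇒≡ : ∀ {a b} → true ≡ not (a xor b) → b ≡ a
      true≡not-xor⇒≡ {true}  {true}  _ = refl
      true≡not-xor⇒≡ {false} {false} _ = refl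
    along : ∀ k → lookup S (next k) ≡ false → lookup T (next k) ≡ not (lookup R k xor lookup T k)
    along k next-k∉S = subst (λ a → a xor lookup T (next k) ≡ not (lookup R k xor lookup T k)) next-k∉S
                         (Equivalence.to (β≡0⇔ R S T k) (β≡0 k))

  ArcRules⇒Adapted : ∀ {R S T} → ArcRules R S T → (∀ s → lookup S s ≡ true → lookup T s ≡ false) → Adapted R S T
  ArcRules⇒Adapted {R} {S} {T} (arcRules at-end along) disjoint = adapted β≡0 disjoint
    where
    β≡0 : ∀ j → β R S T j ≡ 0ℤ
    β≡0 j = Equivalence.from (β≡0⇔ R S T j) (rule (lookup S (next j)) refl)
      where
      rule : ∀ b → lookup S (next j) ≡ b → lookup S (next j) xor lookup T (next j) ≡ not (lookup R j xor lookup T j)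
      rule true  eq rewrite eq | disjoint (next j) eq | at-end j eq | Boolₚ.xor-same (lookup R j) = refl
      rule false eq rewrite eq = along j eq

  IsΦ⇒ArcRules : ∀ {R S T} → IsΦ R S T → ArcRules R S T
  IsΦ⇒ArcRules {R} {S} {T} (at-ends , along) = arcRules at-end along′
    where
    at-end : ∀ k → lookup S (next k) ≡ true → lookup T k ≡ lookup R k
    at-end k next-k∈S = subst (λ i → lookup T i ≡ lookup R i) (prev-next k) (⇔⇒lookup≡ (at-ends (next k) (lookup⇒∈ next-k∈S)))
      where
      ⇔⇒lookup≡ : ∀ {i} → (i ∈ T ⇔ i ∈ R) → lookup T i ≡ lookup R i
      ⇔⇒lookup≡ {i} T⇔R with lookup T i in Ti | lookup R i in Ri
      ... | true  | true  = refl
      ... | false | false = refl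
      ... | true  | false = ⊥-elim (lookup⇒∉ Ri (Equivalence.to T⇔R (lookup⇒∈ Ti)))
      ... | false | true  = ⊥-elim (lookup⇒∉ Ti (Equivalence.from T⇔R (lookup⇒∈ Ri)))
    along′ : ∀ k → lookup S (next k) ≡ false → lookup T (next k) ≡ not (lookup R k xor lookup T k)
    along′ k next-k∉S with lookup R k in Rk | along k (lookup⇒∉ next-k∉S)
    ... | false | (outside , _) with outside (lookup⇒∉ Rk)
    ...   | inj₁ (k∈T , next-k∉T) rewrite ∈⇒lookup k∈T | ∉⇒lookup next-k∉T = refl
    ...   | inj₂ (k∉T , next-k∈T) rewrite ∉⇒lookup k∉T | ∈⇒lookup next-k∈T = refl
    along′ k next-k∉S | true | (_ , inside) with inside (lookup⇒∈ Rk)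
    ...   | inj₁ (k∈T , next-k∈T) rewrite ∈⇒lookup k∈T | ∈⇒lookup next-k∈T = refl
    ...   | inj₂ (k∉T , next-k∉T) rewrite ∉⇒lookup k∉T | ∉⇒lookup next-k∉T = refl

  ArcRules⇒IsΦ : ∀ {R S T} → ArcRules R S T → IsΦ R S T
  ArcRules⇒IsΦ {R} {S} {T} (arcRules at-end along) = at-ends , λ i next-i∉S → outside i next-i∉S , inside i next-i∉S
    where
    at-ends : ∀ s → s ∈ S → (prev s ∈ T ⇔ prev s ∈ R)
    at-ends s s∈S = mk⇔ (λ ∈T → lookup⇒∈ (trans (sym T≡R) (∈⇒lookup ∈T))) (λ ∈R → lookup⇒∈ (trans T≡R (∈⇒lookup ∈R)))
      where
      T≡R : lookup T (prev s) ≡ lookup R (prev s)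
      T≡R = at-end (prev s) (trans (cong (lookup S) (next-prev s)) (∈⇒lookup s∈S))
    next-T : ∀ i → next i ∉ S → lookup T (next i) ≡ not (lookup R i xor lookup T i)
    next-T i next-i∉S = along i (∉⇒lookup next-i∉S)
    outside : ∀ i → next i ∉ S → i ∉ R → (i ∈ T × next i ∉ T) ⊎ (i ∉ T × next i ∈ T)
    outside i next-i∉S i∉R with lookup T i in Ti
    ... | true  = inj₁ (lookup⇒∈ Ti , lookup⇒∉ (trans (next-T i next-i∉S) (cong₂ (λ a b → not (a xor b)) (∉⇒lookup i∉R) Ti)))
    ... | false = inj₂ (lookup⇒∉ Ti , lookup⇒∈ (trans (next-T i next-i∉S) (cong₂ (λ a b → not (a xor b)) (∉⇒lookup i∉R) Ti)))
    inside : ∀ i → next i ∉ S → i ∈ R → (i ∈ T × next i ∈ T) ⊎ (i ∉ T × next i ∉ T)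
    inside i next-i∉S i∈R with lookup T i in Ti
    ... | true  = inj₁ (lookup⇒∈ Ti , lookup⇒∈ (trans (next-T i next-i∉S) (cong₂ (λ a b → not (a xor b)) (∈⇒lookup i∈R) Ti)))
    ... | false = inj₂ (lookup⇒∉ Ti , lookup⇒∉ (trans (next-T i next-i∉S) (cong₂ (λ a b → not (a xor b)) (∈⇒lookup i∈R) Ti)))

  xorSum-arcs : (c r s t : Fin n → Bool) →
    (∀ k → s (next k) ≡ false → c (next k) ≡ c k) → (∀ k → s (next k) ≡ false → t (next k) ≡ not (r k xor t k)) →
    xorSum (λ k → c k ∧ r k) xor xorSum c ≡ xorSum (λ k → (c k ∧ s k) ∧ t k) xor xorSum (λ k → (c k ∧ s (next k)) ∧ not (t k xor r k))
  xorSum-arcs c r s t c-closed t-along = begin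
    xorSum (λ k → c k ∧ r k) xor xorSum c ≡⟨ xorSum-distrib-xor (λ k → c k ∧ r k) c ⟨
    xorSum L                               ≡⟨ xor≡false⇒≡ L+R≡0 ⟩
    xorSum R                               ≡⟨ xorSum-distrib-xor (λ k → (c k ∧ s k) ∧ t k) _ ⟩
    xorSum (λ k → (c k ∧ s k) ∧ t k) xor xorSum (λ k → (c k ∧ s (next k)) ∧ not (t k xor r k)) ∎
    where
    L R D : Fin n → Bool
    L k = (c k ∧ r k) xor c k
    R k = ((c k ∧ s k) ∧ t k) xor ((c k ∧ s (next k)) ∧ not (t k xor r k))
    D k = c k ∧ not (s k) ∧ t k
    L+R≡0 : xorSum L xor xorSum R ≡ false
    L+R≡0 = begin
      xorSum L xor xorSum R                    ≡⟨ xorSum-distrib-xor L R ⟨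
      xorSum (λ k → L k xor R k)               ≡⟨ xorSum-cong (λ k → arc-step (c k) (c (next k)) (r k) (s k) (s (next k)) (t k) (t (next k))
                                                                              (c-closed k) (t-along k)) ⟩
      xorSum (λ k → D k xor D (next k))        ≡⟨ xorSum-distrib-xor D (D ∘ next) ⟩
      xorSum D xor xorSum (D ∘ next)           ≡⟨ cong (xorSum D xor_) (xorSum-rotate D) ⟩
      xorSum D xor xorSum D                    ≡⟨ Boolₚ.xor-same (xorSum D) ⟩
      false ∎

  module Arcs (S : Subset n) {s₀ : Fin n} (s₀∈S : lookup S s₀ ≡ true) where

    private
      ends starts : Fin n → Bool
      ends k   = lookup S (next k)
      starts k = lookup S k

      iterate-next : ∀ j k → iterate next j k ≡ k ⊕ j
      iterate-next zero    k = sym (⊕-0 k)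
      iterate-next (suc j) k = trans (iterate-next j (next k)) (next-⊕ k j)

      iterate-prev : ∀ j k → iterate prev j (k ⊕ j) ≡ k
      iterate-prev zero    k = ⊕-0 k
      iterate-prev (suc j) k = trans (cong (iterate prev j) (trans (cong prev (sym (⊕-suc k j))) (prev-next (k ⊕ j)))) (iterate-prev j k)

      reaches-end : Reaches next ends
      reaches-end k = j , offset<n (next k) s₀ , trans (cong (lookup S) next-k⊕j≡s₀) s₀∈S
        where
        j = offset (next k) s₀
        next-k⊕j≡s₀ : next (iterate next j k) ≡ s₀
        next-k⊕j≡s₀ = begin
          next (iterate next j k) ≡⟨ cong next (iterate-next j k) ⟩
          next (k ⊕ j)            ≡⟨ ⊕-suc k j ⟩
          k ⊕ suc j               ≡⟨ next-⊕ k j ⟨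
          next k ⊕ j              ≡⟨ ⊕-offset (next k) s₀ ⟩
          s₀ ∎

      reaches-start : Reaches prev starts
      reaches-start k = j , offset<n s₀ k ,
        trans (cong (lookup S) (trans (cong (iterate prev j) (sym (⊕-offset s₀ k))) (iterate-prev j s₀))) s₀∈S
        where
        j = offset s₀ k

      module End   = Find next ends
      module Start = Find prev starts

    arcEnd arcStart : Fin n → Fin n
    arcEnd   = End.find
    arcStart = Start.find

    arcEnd-ends : ∀ k → lookup S (next (arcEnd k)) ≡ true
    arcEnd-ends = End.find-stops reaches-end

    arcStart-∈S : ∀ k → lookup S (arcStart k) ≡ true
    arcStart-∈S = Start.find-stops reaches-start

    arcEnd-fixed : ∀ k → lookup S (next k) ≡ true → arcEnd k ≡ k
    arcEnd-fixed = End.walk-stop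

    arcStart-fixed : ∀ k → lookup S k ≡ true → arcStart k ≡ k
    arcStart-fixed = Start.walk-stop

    arcEnd-next : ∀ k → lookup S (next k) ≡ false → arcEnd k ≡ arcEnd (next k)
    arcEnd-next = End.walk-step reaches-end

    arcStart-next : ∀ k → lookup S (next k) ≡ false → arcStart k ≡ arcStart (next k)
    arcStart-next k next-k∉S = sym (trans (Start.walk-step reaches-start (next k) next-k∉S) (cong arcStart (prev-next k)))

    path-to-arcEnd : ∀ f k → Connected S k (End.walk f k)
    path-to-arcEnd zero    k = ε
    path-to-arcEnd (suc f) k with lookup S (next k) in eq
    ... | true  = ε
    ... | false = inj₁ (refl , lookup⇒∉ eq) ◅ path-to-arcEnd f (next k)

    path-from-arcStart : ∀ f k → Connected S (Start.walk f k) k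
    path-from-arcStart zero    k = ε
    path-from-arcStart (suc f) k with lookup S k in eq
    ... | true  = ε
    ... | false = path-from-arcStart f (prev k) ◅◅ (inj₁ (sym (next-prev k) , lookup⇒∉ (trans (cong (lookup S) (next-prev k)) eq)) ◅ ε)

    arc-induction : (Q : Fin n → Set) → (∀ k → lookup S (next k) ≡ true → Q k) →
      (∀ k → lookup S (next k) ≡ false → Q (next k) → Q k) → ∀ k → Q k
    arc-induction Q at-end along k = go (proj₁ (reaches-end k)) k (proj₂ (proj₂ (reaches-end k)))
      where
      go : ∀ j k → lookup S (next (iterate next j k)) ≡ true → Q k
      go zero    k ends = at-end k ends
      go (suc j) k ends with lookup S (next k) in eq
      ... | true  = at-end k eq
      ... | false = along k eq (go j (next k) ends)

    ArcRules⇒component-parity : ∀ {R T} → ArcRules R S T → ∀ C → IsComponent S C → ∀ {k₀} → k₀ ∈ C →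
      parity ∣ C ∩ R ∣ xor parity ∣ C ∣ ≡ not (lookup T (arcStart k₀))
    ArcRules⇒component-parity {R} {T} (arcRules at-end along) C (_ , closed , connected) {k₀} k₀∈C = begin
      parity ∣ C ∩ R ∣ xor parity ∣ C ∣
        ≡⟨ cong₂ _xor_ (trans (parity-∣∣ (C ∩ R)) (xorSum-cong (λ k → lookup-zipWith _∧_ k C R))) (parity-∣∣ C) ⟩
      xorSum (λ k → c k ∧ lookup R k) xor xorSum c
        ≡⟨ xorSum-arcs c (lookup R) (lookup S) (lookup T) c-closed along ⟩
      xorSum (λ k → (c k ∧ lookup S k) ∧ lookup T k) xor xorSum (λ k → (c k ∧ lookup S (next k)) ∧ not (lookup T k xor lookup R k))
        ≡⟨ cong₂ _xor_ (xorSum-∧-unique _ (lookup T) a (cong₂ _∧_ (∈⇒lookup a∈C) (arcStart-∈S k₀)) (unique arcStart arcStart-next arcStart-fixed))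
                       (xorSum-∧-unique _ _ b (cong₂ _∧_ (∈⇒lookup b∈C) (arcEnd-ends k₀)) (unique arcEnd arcEnd-next arcEnd-fixed)) ⟩
      lookup T a xor not (lookup T b xor lookup R b)
        ≡⟨ cong (λ x → lookup T a xor not x) (trans (cong (_xor lookup R b) (at-end b (arcEnd-ends k₀))) (Boolₚ.xor-same (lookup R b))) ⟩
      lookup T a xor true
        ≡⟨ Boolₚ.xor-comm (lookup T a) true ⟩
      not (lookup T a) ∎
      where
      c = lookup C
      a = arcStart k₀
      b = arcEnd k₀
      a∈C : a ∈ C
      a∈C = path-closed C closed (reverse edge-sym (path-from-arcStart n k₀)) k₀∈C
      b∈C : b ∈ C
      b∈C = path-closed C closed (path-to-arcEnd n k₀) k₀∈C
      c-closed : ∀ k → lookup S (next k) ≡ false → c (next k) ≡ c k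
      c-closed k next-k∉S with c k in ck | c (next k) in c′k
      ... | true  | true  = refl
      ... | false | false = refl
      ... | true  | false = ⊥-elim (lookup⇒∉ c′k (closed k (next k) (lookup⇒∈ ck) (inj₁ (refl , lookup⇒∉ next-k∉S))))
      ... | false | true  = ⊥-elim (lookup⇒∉ ck (closed (next k) k (lookup⇒∈ c′k) (inj₂ (refl , lookup⇒∉ next-k∉S))))
      unique : ∀ {P : Fin n → Bool} (φ : Fin n → Fin n) → (∀ k → lookup S (next k) ≡ false → φ k ≡ φ (next k)) →
        (∀ k → P k ≡ true → φ k ≡ k) → ∀ k → c k ∧ P k ≡ true → k ≡ φ k₀
      unique φ φ-inv φ-fixed k ck∧Pk = trans (sym (φ-fixed k (proj₂ (∧≡true⇒ ck∧Pk))))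
        (sym (path-invariant φ φ-inv (connected k₀ k k₀∈C (lookup⇒∈ (proj₁ (∧≡true⇒ ck∧Pk))))))

    componentOf : Fin n → Subset n
    componentOf s = tabulate (λ k → does (arcStart k Fin.≟ s))

    ∈componentOf⇔ : ∀ {s k} → k ∈ componentOf s ⇔ arcStart k ≡ s
    ∈componentOf⇔ {s} {k} = mk⇔
      (λ k∈ → to (arcStart k Fin.≟ s) (trans (sym (lookup∘tabulate _ k)) (∈⇒lookup k∈)))
      (λ eq → lookup⇒∈ (trans (lookup∘tabulate _ k) (from (arcStart k Fin.≟ s) eq)))
      where
      to : (d : Dec (arcStart k ≡ s)) → does d ≡ true → arcStart k ≡ s
      to (yes eq) _ = eq
      from : (d : Dec (arcStart k ≡ s)) → arcStart k ≡ s → does d ≡ true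
      from (yes _)  _  = refl
      from (no  ne) eq = ⊥-elim (ne eq)

    componentOf-isComponent : ∀ s → lookup S s ≡ true → IsComponent S (componentOf s)
    componentOf-isComponent s s∈S = (s , s∈) , closed , connected
      where
      open Equivalence
      s∈ : s ∈ componentOf s
      s∈ = from ∈componentOf⇔ (arcStart-fixed s s∈S)
      closed : ∀ i j → i ∈ componentOf s → Edge S i j → j ∈ componentOf s
      closed i j i∈ edge = from ∈componentOf⇔ (trans (sym (path-invariant arcStart arcStart-next (edge ◅ ε))) (to ∈componentOf⇔ i∈))
      connected : ∀ i j → i ∈ componentOf s → j ∈ componentOf s → Connected S i j
      connected i j i∈ j∈ = reverse edge-sym (path-from-arcStart n i) ◅◅
        subst (λ a → Connected S a j) (trans (to ∈componentOf⇔ j∈) (sym (to ∈componentOf⇔ i∈))) (path-from-arcStart n j)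

    Adapted⇒parity : ∀ {R T} → Adapted R S T → ∀ C → IsComponent S C → ∣ C ∩ R ∣ % 2 ≢ ∣ C ∣ % 2
    Adapted⇒parity {R} {T} T-adapted C C-comp@((k₀ , k₀∈C) , _) = Equivalence.from (%2≢⇔parity-xor ∣ C ∩ R ∣ ∣ C ∣)
      (trans (ArcRules⇒component-parity (Adapted⇒ArcRules T-adapted) C C-comp k₀∈C)
             (cong not (Adapted.disjoint T-adapted (arcStart k₀) (arcStart-∈S k₀))))

    parity⇒disjoint : ∀ {R T} → ArcRules R S T → (∀ C → IsComponent S C → ∣ C ∩ R ∣ % 2 ≢ ∣ C ∣ % 2) →
      ∀ s → lookup S s ≡ true → lookup T s ≡ false
    parity⇒disjoint {R} {T} rules parities s s∈S = not≡true⇒≡false (begin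
      not (lookup T s)                       ≡⟨ cong (not ∘ lookup T) (arcStart-fixed s s∈S) ⟨
      not (lookup T (arcStart s))            ≡⟨ ArcRules⇒component-parity rules C C-comp (Equivalence.from ∈componentOf⇔ (arcStart-fixed s s∈S)) ⟨
      parity ∣ C ∩ R ∣ xor parity ∣ C ∣       ≡⟨ Equivalence.to (%2≢⇔parity-xor ∣ C ∩ R ∣ ∣ C ∣) (parities C C-comp) ⟩
      true ∎)
      where
      C = componentOf s
      C-comp = componentOf-isComponent s s∈S
      not≡true⇒≡false : ∀ {x} → not x ≡ true → x ≡ false
      not≡true⇒≡false {false} _ = refl

    -- the end rule fixes Φ at the last vertex of each arc, and the edge rule read backwards determines the rest
    private
      module ΦWalk (R : Subset n) = Walk next ends (lookup R) (λ k v → not (lookup R k xor v))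

    Φ : Subset n → Subset n
    Φ R = tabulate (ΦWalk.walk R n)

    Φ-ArcRules : ∀ R → ArcRules R S (Φ R)
    Φ-ArcRules R = arcRules at-end along
      where
      open ΦWalk R
      at-end : ∀ k → lookup S (next k) ≡ true → lookup (Φ R) k ≡ lookup R k
      at-end k next-k∈S = trans (lookup∘tabulate _ k) (walk-stop k next-k∈S)
      along : ∀ k → lookup S (next k) ≡ false → lookup (Φ R) (next k) ≡ not (lookup R k xor lookup (Φ R) k)
      along k next-k∉S = trans (lookup∘tabulate _ (next k))
        (trans (≡not-xor-swap (lookup R k) (walk n k) (walk n (next k)) (walk-step reaches-end k next-k∉S))
               (cong (λ v → not (lookup R k xor v)) (sym (lookup∘tabulate _ k))))

    ArcRules-unique : ∀ {R T T′} → ArcRules R S T → ArcRules R S T′ → ∀ k → lookup T k ≡ lookup T′ k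
    ArcRules-unique {R} {T} {T′} (arcRules at-end along) (arcRules at-end′ along′) = arc-induction (λ k → lookup T k ≡ lookup T′ k)
      (λ k next-k∈S → trans (at-end k next-k∈S) (sym (at-end′ k next-k∈S)))
      (λ k next-k∉S T≡T′ → begin
        lookup T k                              ≡⟨ ≡not-xor-swap (lookup R k) (lookup T (next k)) (lookup T k) (along k next-k∉S) ⟩
        not (lookup R k xor lookup T (next k))  ≡⟨ cong (λ v → not (lookup R k xor v)) T≡T′ ⟩
        not (lookup R k xor lookup T′ (next k)) ≡⟨ ≡not-xor-swap (lookup R k) (lookup T′ (next k)) (lookup T′ k) (along′ k next-k∉S) ⟨
        lookup T′ k ∎)

    C-RS⇔HomCone-Φ : ∀ p R x → C-RS p R S x ⇔ HomCone p (Φ R) S x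
    C-RS⇔HomCone-Φ p R x = mk⇔
      (λ { (T , isΦ , x∈cone) d d∈S →
             subst (ℤ._≤ 0ℤ) (F-cong-lookup p d x (ArcRules-unique (IsΦ⇒ArcRules {R} {S} {T} isΦ) (Φ-ArcRules R))) (x∈cone d d∈S) })
      (λ x∈cone → Φ R , ArcRules⇒IsΦ (Φ-ArcRules R) , x∈cone)

two-elements : ∀ {m} (X : Subset m) → 2 ≤ ∣ X ∣ → ∃[ a ] ∃[ b ] (a ≢ b × lookup X a ≡ true × lookup X b ≡ true)
two-elements (true  ∷ X) 2≤∣X∣ with one-element X (ℕₚ.≤-pred 2≤∣X∣)
  where
  one-element : ∀ {m} (X : Subset m) → 1 ≤ ∣ X ∣ → ∃[ a ] lookup X a ≡ true
  one-element (true  ∷ X) _     = Fin.zero , refl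
  one-element (false ∷ X) 1≤∣X∣ with one-element X 1≤∣X∣
  ... | a , a∈X = Fin.suc a , a∈X
... | b , b∈X = Fin.zero , Fin.suc b , (λ ()) , refl , b∈X
two-elements (false ∷ X) 2≤∣X∣ with two-elements X 2≤∣X∣
... | a , b , a≢b , a∈X , b∈X = Fin.suc a , Fin.suc b , a≢b ∘ Finₚ.suc-injective , a∈X , b∈X

theorem5p9p2 : (n : ℕ) .{{_ : NonZero n}} (p : ℕ) → Prime p →
    (R S : Subset n) → 2 ≤ ∣ S ∣ →
    ((∀ (x : Fin n → ℤ) → C-RS p R S x ⇔ C-pHa p R S x)
       ⇔ (∃[ T ] (∀ (x : Fin n → ℤ) → C-pHa p R S x ⇔ HomCone p T S x)))
    × ((∃[ T ] (∀ (x : Fin n → ℤ) → C-pHa p R S x ⇔ HomCone p T S x))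
       ⇔ (∀ (C : Subset n) → IsComponent S C → ∣ C ∩ R ∣ % 2 ≢ ∣ C ∣ % 2))
theorem5p9p2 n p p-prime R S 2≤∣S∣ with two-elements S 2≤∣S∣
... | s₁ , s₂ , s₁≢s₂ , s₁∈S , s₂∈S = mk⇔ i⇒ii (iii⇒i ∘ ii⇒iii) , mk⇔ ii⇒iii (i⇒ii ∘ iii⇒i)
  where
  open Arcs S s₁∈S
  2≤p : 2 ≤ p
  2≤p = ℕ.nonTrivial⇒n>1 p {{prime⇒nonTrivial p-prime}}
  i⇒ii : (∀ x → C-RS p R S x ⇔ C-pHa p R S x) → ∃[ T ] (∀ x → C-pHa p R S x ⇔ HomCone p T S x)
  i⇒ii C-RS≡C-pHa = Φ R , λ x → ⇔.trans (⇔.sym (C-RS≡C-pHa x)) (C-RS⇔HomCone-Φ p R x)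
  ii⇒iii : ∃[ T ] (∀ x → C-pHa p R S x ⇔ HomCone p T S x) → ∀ C → IsComponent S C → ∣ C ∩ R ∣ % 2 ≢ ∣ C ∣ % 2
  ii⇒iii (T , homogeneous) = Adapted⇒parity (homogeneous⇒Adapted p 2≤p R S T s₁≢s₂ s₁∈S s₂∈S homogeneous)
  iii⇒i : (∀ C → IsComponent S C → ∣ C ∩ R ∣ % 2 ≢ ∣ C ∣ % 2) → ∀ x → C-RS p R S x ⇔ C-pHa p R S x
  iii⇒i parities x = ⇔.trans (C-RS⇔HomCone-Φ p R x) (⇔.sym (Adapted⇒C-pHa⇔HomCone p 2≤p R S (Φ R) Φ-adapted x))
    where
    Φ-adapted : Adapted R S (Φ R)
    Φ-adapted = ArcRules⇒Adapted (Φ-ArcRules R) (parity⇒disjoint (Φ-ArcRules R) parities)
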